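{- Let $G=U(T_1,\dots,T_g)$ be a unicyclic graph of order $n$ with girth $g$, cycle $C_g=u_1\cdots u_g$, and $n_i=|V(T_i)|$. Then $$W(G)=\Big(n-\frac g2\Big)\Big\lfloor\frac{g^2}{4}\Big\rfloor+(g-1)\sum_{i=1}^g d_{T_i}(u_i)+\sum_{i=1}^g W(T_i)+\sum_{i=1}^{g-1}\sum_{j=i+1}^{g}\Big[(n_i-1)d_{T_j}(u_j)+(n_j-1)d_{T_i}(u_i)+(n_i-1)(n_j-1)d_{C_g}(u_i,u_j)\Big].$$
   Context: All graphs are finite, simple, undirected and connected. $d_H(u,v)$ is the distance in $H$; for a vertex $v$, $d_H(v)=\sum_{w\in V(H)} d_H(v,w)$; $W(H)=\sum_{\{u,v\}\subseteq V(H)} d_H(u,v)$ is the Wiener index. A unicyclic graph is a connected graph with exactly one cycle, its girth the cycle length. If $C_g=u_1\cdots u_g$ is the cycle of the unicyclic graph $G$, then $G-E(C_g)$ consists of $g$ trees $T_1,\dots,T_g$ with $u_i\in V(T_i)$, and we write $G=U(T_1,\dots,T_g)$. -}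

module Defs where

open import Data.Nat using (ℕ; zero; suc; _+_; _*_; _∸_; _≤_; _≡ᵇ_; _<ᵇ_)
open import Data.Fin using (Fin; zero; suc; toℕ; _≟_)
open import Data.Bool using (Bool; true; false; _∧_; _∨_; not; if_then_else_)
open import Data.Product using (Σ; _×_; ∃)
open import Relation.Nullary using (does)
open import Relation.Binary.PropositionalEquality using (_≡_)
open import Function.Definitions using (Injective)

Graph : ℕ → Set
Graph n = Fin n → Fin n → Bool

∑ : (k : ℕ) → (Fin k → ℕ) → ℕ
∑ zero    f = 0
∑ (suc k) f = f zero + ∑ k (λ i → f (suc i))

anyF : (k : ℕ) → (Fin k → Bool) → Bool
anyF zero    f = false
anyF (suc k) f = f zero ∨ anyF k (λ i → f (suc i))

pairSum : (k : ℕ) → (Fin k → Fin k → ℕ) → ℕ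
pairSum k f = ∑ k (λ i → ∑ k (λ j → if toℕ i <ᵇ toℕ j then f i j else 0))

count : (k : ℕ) → (Fin k → Bool) → ℕ
count k p = ∑ k (λ i → if p i then 1 else 0)

IsSimple : ∀ {n} → Graph n → Set
IsSimple {n} A = (∀ x y → A x y ≡ A y x) × (∀ x → A x x ≡ false)

-- reach A k x y = true  iff there is a walk from x to y of length ≤ k in A
reach : ∀ {n} → Graph n → ℕ → Fin n → Fin n → Bool
reach     A zero    x y = does (x ≟ y)
reach {n} A (suc k) x y = reach A k x y ∨ anyF n (λ w → reach A k x w ∧ A w y)

IsConnected : ∀ {n} → Graph n → Set
IsConnected A = ∀ x y → ∃ λ k → reach A k x y ≡ true

-- distance: the least k with a walk of length ≤ k from x to y, computed as the
-- number of k ∈ {0,…,n-1} with no such walk (reach is monotone in k, and any two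
-- vertices in the same component are joined by a walk of length ≤ n-1).
dist : ∀ {n} → Graph n → Fin n → Fin n → ℕ
dist {n} A x y = count n (λ k → not (reach A (toℕ k) x y))

W : ∀ {n} → Graph n → ℕ
W {n} A = pairSum n (λ x y → dist A x y)

Wsub : ∀ {n} → Graph n → (Fin n → Bool) → ℕ
Wsub {n} A S = pairSum n (λ x y → if S x ∧ S y then dist A x y else 0)

dsub : ∀ {n} → Graph n → (Fin n → Bool) → Fin n → ℕ
dsub {n} A S v = ∑ n (λ w → if S w then dist A v w else 0)

cycSucc : (k : ℕ) → Fin k → Fin k → Bool
cycSucc k i j = (suc (toℕ i) ≡ᵇ toℕ j) ∨ ((toℕ i ≡ᵇ (k ∸ 1)) ∧ (toℕ j ≡ᵇ 0))

IsCycle : ∀ {n} → Graph n → (k : ℕ) → (Fin k → Fin n) → Set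
IsCycle A k c = (3 ≤ k) × Injective _≡_ _≡_ c
              × (∀ i j → cycSucc k i j ≡ true → A (c i) (c j) ≡ true)

cycAdj : ∀ {n} (k : ℕ) → (Fin k → Fin n) → Graph n
cycAdj k c x y = anyF k (λ i → anyF k (λ j → cycSucc k i j ∧
                   ((does (x ≟ c i) ∧ does (y ≟ c j)) ∨ (does (x ≟ c j) ∧ does (y ≟ c i)))))

-- G is a (connected, simple) unicyclic graph whose unique cycle is u :
-- every cycle of G has the same edge set as u.
IsUnicyclicWith : ∀ {n} → Graph n → (g : ℕ) → (Fin g → Fin n) → Set
IsUnicyclicWith {n} A g u =
  IsSimple A × IsConnected A × IsCycle A g u
  × (∀ k c → IsCycle A k c → ∀ x y → cycAdj k c x y ≡ cycAdj g u x y)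

delCycle : ∀ {n} → Graph n → (g : ℕ) → (Fin g → Fin n) → Graph n
delCycle A g u x y = A x y ∧ not (cycAdj g u x y)

-- vertex set of T_i: the component of u_i in G - E(C_g)
inT : ∀ {n} → Graph n → (g : ℕ) → (Fin g → Fin n) → Fin g → Fin n → Bool
inT {n} A g u i w = reach (delCycle A g u) n (u i) w

-- the tree T_i as a graph on Fin n (vertices outside T_i are isolated)
treeAdj : ∀ {n} → Graph n → (g : ℕ) → (Fin g → Fin n) → Fin g → Graph n
treeAdj A g u i x y = delCycle A g u x y ∧ inT A g u i x ∧ inT A g u i y

-- Deleting the cycle edges leaves trees T_i hanging at the cycle vertices u_i, and distinct
-- trees are disjoint: a path of G − E(C_g) between two cycle vertices, closed up by an arc of
-- C_g, would be a second cycle. Hence d_G(x,y) = d_{T_i}(x,y) inside one tree, and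
-- d_G(x,y) = d_{T_i}(u_i,x) + d_{C_g}(u_i,u_j) + d_{T_j}(u_j,y) for x ∈ T_i, y ∈ T_j, i ≠ j.
-- Summing over ordered pairs, 2W(G) is ∑ 2W(T_i) plus the cross terms; every row of cycle
-- distances sums to ⌊g²/4⌋, and n = g + ∑ (n_i − 1) collects the cycle contributions into
-- (2n − g)⌊g²/4⌋.

module Submission where

open import Data.Bool using (Bool; true; false; _∧_; _∨_; not; if_then_else_)
import Data.Bool as Bool
open import Data.Bool.Properties using (∧-comm; ∨-comm)
open import Data.Empty using (⊥; ⊥-elim)
open import Data.Fin using (Fin; zero; suc; toℕ; fromℕ<; _≟_)
import Data.Fin.Properties as Finₚ
open import Data.Nat using (ℕ; zero; suc; _+_; _*_; _∸_; _/_; _⊓_; _≤_; _<_; _≡ᵇ_; _<ᵇ_; _≤ᵇ_; z≤n; s≤s; _≤?_; _<?_)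
  renaming (_≟_ to _≟ℕ_)
open import Data.Nat.DivMod using (m*n/n≡m; +-distrib-/-∣ˡ)
open import Data.Nat.Divisibility using (divides-refl)
open import Data.Nat.Properties hiding (_≟_)
open import Algebra.Properties.CommutativeSemigroup +-commutativeSemigroup
  using () renaming (interchange to +-interchange; x∙yz≈y∙xz to +-left-comm)
open import Data.Nat.Solver using (module +-*-Solver)
open import Data.Product using (Σ; _×_; _,_; proj₁; proj₂)
open import Data.Sum using (_⊎_; inj₁; inj₂)
open import Function.Definitions using (Injective)
open import Relation.Binary using (tri<; tri≈; tri>)
open import Relation.Binary.PropositionalEquality
  using (_≡_; _≢_; refl; sym; trans; cong; cong₂; subst; subst₂; module ≡-Reasoning)
open import Relation.Nullary using (does; yes; no; ¬_; Dec)
open import Relation.Nullary.Decidable using (_×-dec_; dec-true; dec-false)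

open import Defs

open +-*-Solver using (solve; _:+_; _:*_; _:=_; con)
open ≡-Reasoning

-- Booleans and finite sums

∨-true⇒ : ∀ a b → a ∨ b ≡ true → a ≡ true ⊎ b ≡ true
∨-true⇒ true b p = inj₁ refl
∨-true⇒ false b p = inj₂ p

∨-trueˡ : ∀ a b → a ≡ true → a ∨ b ≡ true
∨-trueˡ true b p = refl

∨-trueʳ : ∀ a b → b ≡ true → a ∨ b ≡ true
∨-trueʳ true b p = refl
∨-trueʳ false b p = p

∧-true⇒ : ∀ a b → a ∧ b ≡ true → a ≡ true × b ≡ true
∧-true⇒ true true p = refl , refl

∧-true : ∀ {a b} → a ≡ true → b ≡ true → a ∧ b ≡ true
∧-true refl refl = refl

true≢false : true ≢ false
true≢false ()

does-≟-refl : ∀ {k} (x : Fin k) → does (x ≟ x) ≡ true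
does-≟-refl x = dec-true (x ≟ x) refl

does-≟⇒≡ : ∀ {k} (x y : Fin k) → does (x ≟ y) ≡ true → x ≡ y
does-≟⇒≡ x y p with x ≟ y
... | yes q = q
does-≟⇒≡ x y () | no _

does-≟-≢ : ∀ {k} (x y : Fin k) → x ≢ y → does (x ≟ y) ≡ false
does-≟-≢ x y = dec-false (x ≟ y)

does-≟-sym : ∀ {k} (i j : Fin k) → does (i ≟ j) ≡ does (j ≟ i)
does-≟-sym i j with i ≟ j
... | yes refl = sym (does-≟-refl i)
... | no i≢j = sym (does-≟-≢ j i (λ j≡i → i≢j (sym j≡i)))

anyF-true⇒ : ∀ k (f : Fin k → Bool) → anyF k f ≡ true → Σ (Fin k) (λ i → f i ≡ true)
anyF-true⇒ (suc k) f p with f zero in eq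
... | true = zero , eq
... | false with anyF-true⇒ k (λ i → f (suc i)) p
... | i , q = suc i , q

anyF-true : ∀ k (f : Fin k → Bool) (i : Fin k) → f i ≡ true → anyF k f ≡ true
anyF-true (suc k) f zero p = ∨-trueˡ _ _ p
anyF-true (suc k) f (suc i) p = ∨-trueʳ (f zero) _ (anyF-true k (λ j → f (suc j)) i p)

anyF-false⇒ : ∀ k (f : Fin k → Bool) → anyF k f ≡ false → ∀ i → f i ≡ false
anyF-false⇒ k f p i with f i in eq
... | false = refl
... | true = ⊥-elim (true≢false (trans (sym (anyF-true k f i eq)) p))

∨∧-swap : ∀ a b c d → (a ∧ b) ∨ (c ∧ d) ≡ (d ∧ c) ∨ (b ∧ a)
∨∧-swap a b c d = trans (∨-comm (a ∧ b) (c ∧ d)) (cong₂ _∨_ (∧-comm c d) (∧-comm a b))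

anyF-cong : ∀ k (f h : Fin k → Bool) → (∀ i → f i ≡ h i) → anyF k f ≡ anyF k h
anyF-cong zero f h e = refl
anyF-cong (suc k) f h e = cong₂ _∨_ (e zero) (anyF-cong k _ _ (λ i → e (suc i)))

<⇒<ᵇ-true : ∀ {a b} → a < b → (a <ᵇ b) ≡ true
<⇒<ᵇ-true {a} {b} lt with a <ᵇ b in e
... | true = refl
... | false = ⊥-elim (subst Bool.T e (<⇒<ᵇ lt))

≤⇒≤ᵇ-true : ∀ {a b} → a ≤ b → (a ≤ᵇ b) ≡ true
≤⇒≤ᵇ-true {a} {b} le with a ≤ᵇ b in e
... | true = refl
... | false = ⊥-elim (subst Bool.T e (≤⇒≤ᵇ le))

≤⇒<ᵇ-false : ∀ {a b} → b ≤ a → (a <ᵇ b) ≡ false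
≤⇒<ᵇ-false {a} {b} le with a <ᵇ b in e
... | false = refl
... | true = ⊥-elim (<⇒≱ (<ᵇ⇒< a b (subst Bool.T (sym e) _)) le)

≡ᵇ-refl : ∀ m → (m ≡ᵇ m) ≡ true
≡ᵇ-refl zero = refl
≡ᵇ-refl (suc m) = ≡ᵇ-refl m

≡ᵇ-true⇒≡ : ∀ {m k} → (m ≡ᵇ k) ≡ true → m ≡ k
≡ᵇ-true⇒≡ {m} {k} p = ≡ᵇ⇒≡ m k (subst Bool.T (sym p) _)

≡⇒≡ᵇ-true : ∀ {m k} → m ≡ k → (m ≡ᵇ k) ≡ true
≡⇒≡ᵇ-true {m} refl = ≡ᵇ-refl m

∑ℕ : ℕ → (ℕ → ℕ) → ℕ
∑ℕ zero f = 0
∑ℕ (suc k) f = f 0 + ∑ℕ k (λ t → f (suc t))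

∑-toℕ : ∀ k (f : ℕ → ℕ) → ∑ k (λ i → f (toℕ i)) ≡ ∑ℕ k f
∑-toℕ zero f = refl
∑-toℕ (suc k) f = cong (f 0 +_) (∑-toℕ k (λ t → f (suc t)))

∑-cong : ∀ k (f h : Fin k → ℕ) → (∀ i → f i ≡ h i) → ∑ k f ≡ ∑ k h
∑-cong zero f h e = refl
∑-cong (suc k) f h e = cong₂ _+_ (e zero) (∑-cong k _ _ (λ i → e (suc i)))

∑-+ : ∀ k (f h : Fin k → ℕ) → ∑ k (λ i → f i + h i) ≡ ∑ k f + ∑ k h
∑-+ zero f h = refl
∑-+ (suc k) f h rewrite ∑-+ k (λ i → f (suc i)) (λ i → h (suc i)) = +-interchange (f zero) (h zero) _ _

∑-*ˡ : ∀ k (c : ℕ) (f : Fin k → ℕ) → ∑ k (λ i → c * f i) ≡ c * ∑ k f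
∑-*ˡ zero c f = sym (*-zeroʳ c)
∑-*ˡ (suc k) c f = trans (cong (c * f zero +_) (∑-*ˡ k c (λ i → f (suc i)))) (sym (*-distribˡ-+ c (f zero) _))

∑-*ʳ : ∀ k (c : ℕ) (f : Fin k → ℕ) → ∑ k (λ i → f i * c) ≡ ∑ k f * c
∑-*ʳ k c f = trans (∑-cong k _ _ (λ i → *-comm (f i) c)) (trans (∑-*ˡ k c f) (*-comm c _))

∑≡0 : ∀ k (f : Fin k → ℕ) → (∀ i → f i ≡ 0) → ∑ k f ≡ 0
∑≡0 zero f e = refl
∑≡0 (suc k) f e rewrite e zero = ∑≡0 k _ (λ i → e (suc i))

∑-const : ∀ k c → ∑ k (λ _ → c) ≡ k * c
∑-const zero c = refl
∑-const (suc k) c = cong (c +_) (∑-const k c)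

∑-swap : ∀ k m (f : Fin k → Fin m → ℕ) → ∑ k (λ i → ∑ m (λ j → f i j)) ≡ ∑ m (λ j → ∑ k (λ i → f i j))
∑-swap zero m f = sym (∑≡0 m _ (λ _ → refl))
∑-swap (suc k) m f = trans (cong (∑ m (f zero) +_) (∑-swap k m (λ i j → f (suc i) j)))
                      (sym (∑-+ m (f zero) (λ j → ∑ k (λ i → f (suc i) j))))

ind : Bool → ℕ → ℕ
ind b x = if b then x else 0

∑-delta : ∀ k (i : Fin k) (f : Fin k → ℕ) → ∑ k (λ j → ind (does (i ≟ j)) (f j)) ≡ f i
∑-delta (suc k) zero f = trans (cong (f zero +_) (∑≡0 k _ (λ j → refl))) (+-identityʳ _)
∑-delta (suc k) (suc i) f = ∑-delta k i (λ j → f (suc j))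

count≤ : ∀ k (p : Fin k → Bool) → count k p ≤ k
count≤ zero p = z≤n
count≤ (suc k) p with p zero
... | true = s≤s (count≤ k _)
... | false = m≤n⇒m≤1+n (count≤ k _)

count-mono : ∀ k (p q : Fin k → Bool) → (∀ w → p w ≡ true → q w ≡ true) → count k p ≤ count k q
count-mono zero p q h = z≤n
count-mono (suc k) p q h with p zero in e1 | q zero in e2
... | true | true = s≤s (count-mono k _ _ (λ w → h (suc w)))
... | true | false = ⊥-elim (true≢false (trans (sym (h zero e1)) e2))
... | false | true = m≤n⇒m≤1+n (count-mono k _ _ (λ w → h (suc w)))
... | false | false = count-mono k _ _ (λ w → h (suc w))

count-< : ∀ k (p q : Fin k → Bool) → (∀ w → p w ≡ true → q w ≡ true) →
  (w0 : Fin k) → q w0 ≡ true → p w0 ≡ false → suc (count k p) ≤ count k q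
count-< (suc k) p q h zero e1 e2 rewrite e1 | e2 = s≤s (count-mono k _ _ (λ w → h (suc w)))
count-< (suc k) p q h (suc w0) e1 e2 with p zero in f1 | q zero in f2
... | true | true = s≤s (count-< k _ _ (λ w → h (suc w)) w0 e1 e2)
... | true | false = ⊥-elim (true≢false (trans (sym (h zero f1)) f2))
... | false | true = s≤s (<⇒≤ (count-< k _ _ (λ w → h (suc w)) w0 e1 e2))
... | false | false = count-< k _ _ (λ w → h (suc w)) w0 e1 e2

ind-+ : ∀ b x y → ind b (x + y) ≡ ind b x + ind b y
ind-+ true x y = refl
ind-+ false x y = refl

ind-∑ : ∀ b k (f : Fin k → ℕ) → ind b (∑ k f) ≡ ∑ k (λ i → ind b (f i))
ind-∑ true k f = refl
ind-∑ false k f = sym (∑≡0 k _ (λ _ → refl))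

ind-*ˡ : ∀ b c x → c * ind b x ≡ ind b (c * x)
ind-*ˡ true c x = refl
ind-*ˡ false c x = *-zeroʳ c

ind-1 : ∀ b x → ind b 1 * x ≡ ind b x
ind-1 true x = +-identityʳ x
ind-1 false x = refl

trichotomy-split : ∀ {k} (i j : Fin k) x → x ≡ ind (toℕ i <ᵇ toℕ j) x + ind (toℕ j <ᵇ toℕ i) x + ind (does (i ≟ j)) x
trichotomy-split i j x with <-cmp (toℕ i) (toℕ j)
... | tri< lt _ _ rewrite <⇒<ᵇ-true lt | ≤⇒<ᵇ-false {toℕ j} {toℕ i} (<⇒≤ lt) | does-≟-≢ i j (λ e → <⇒≢ lt (cong toℕ e)) = sym (trans (+-identityʳ _) (+-identityʳ x))
... | tri≈ _ e _ rewrite Finₚ.toℕ-injective {i = i} {j} e | ≤⇒<ᵇ-false {toℕ j} {toℕ j} ≤-refl | does-≟-refl j = refl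
... | tri> _ _ gt rewrite ≤⇒<ᵇ-false {toℕ i} {toℕ j} (<⇒≤ gt) | <⇒<ᵇ-true gt | does-≟-≢ i j (λ e → <⇒≢ gt (cong toℕ (sym e))) = sym (+-identityʳ x)

∑∑-+ : ∀ k m (f h : Fin k → Fin m → ℕ) → ∑ k (λ i → ∑ m (λ j → f i j + h i j)) ≡ ∑ k (λ i → ∑ m (f i)) + ∑ k (λ i → ∑ m (h i))
∑∑-+ k m f h = trans (∑-cong k _ _ (λ i → ∑-+ m (f i) (h i))) (∑-+ k _ _)

∑∑≡2*pairSum+diagonal : ∀ k (f : Fin k → Fin k → ℕ) → (∀ i j → f i j ≡ f j i) →
   ∑ k (λ i → ∑ k (λ j → f i j)) ≡ 2 * pairSum k f + ∑ k (λ i → f i i)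
∑∑≡2*pairSum+diagonal k f sy = begin
    ∑ k (λ i → ∑ k (λ j → f i j))
  ≡⟨ ∑-cong k _ _ (λ i → ∑-cong k _ _ (λ j → trichotomy-split i j (f i j))) ⟩
    ∑ k (λ i → ∑ k (λ j → A i j + B i j + D i j))
  ≡⟨ ∑∑-+ k k (λ i j → A i j + B i j) D ⟩
    ∑ k (λ i → ∑ k (λ j → A i j + B i j)) + ∑ k (λ i → ∑ k (D i))
  ≡⟨ cong₂ _+_ (∑∑-+ k k A B) (∑-cong k _ _ (λ i → ∑-delta k i (f i))) ⟩
    pairSum k f + ∑ k (λ i → ∑ k (B i)) + ∑ k (λ i → f i i)
  ≡⟨ cong (λ z → pairSum k f + z + ∑ k (λ i → f i i)) Beq ⟩
    pairSum k f + pairSum k f + ∑ k (λ i → f i i)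
  ≡⟨ cong (λ z → pairSum k f + z + ∑ k (λ i → f i i)) (sym (+-identityʳ (pairSum k f))) ⟩
    2 * pairSum k f + ∑ k (λ i → f i i) ∎
  where
  A B D : Fin k → Fin k → ℕ
  A i j = ind (toℕ i <ᵇ toℕ j) (f i j)
  B i j = ind (toℕ j <ᵇ toℕ i) (f i j)
  D i j = ind (does (i ≟ j)) (f i j)
  Beq : ∑ k (λ i → ∑ k (B i)) ≡ pairSum k f
  Beq = trans (∑-swap k k B) (∑-cong k _ _ (λ i → ∑-cong k _ _ (λ j → cong (ind (toℕ i <ᵇ toℕ j)) (sy j i))))

∑-ind≡count* : ∀ k (p : Fin k → Bool) c → ∑ k (λ i → ind (p i) c) ≡ count k p * c
∑-ind≡count* k p c = trans (∑-cong k _ _ (λ i → sym (ind-1 (p i) c))) (∑-*ʳ k c (λ i → ind (p i) 1))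

∑-off-diagonal-const : ∀ g1 (a : Fin (suc g1)) x → ∑ (suc g1) (λ b → ind (not (does (a ≟ b))) x) ≡ g1 * x
∑-off-diagonal-const g1 a x = +-cancelˡ-≡ x _ _ (begin
    x + ∑ (suc g1) (λ b → ind (not (does (a ≟ b))) x)
  ≡⟨ cong (_+ ∑ (suc g1) (λ b → ind (not (does (a ≟ b))) x)) (sym (∑-delta (suc g1) a (λ _ → x))) ⟩
    ∑ (suc g1) (λ b → ind (does (a ≟ b)) x) + ∑ (suc g1) (λ b → ind (not (does (a ≟ b))) x)
  ≡⟨ sym (∑-+ (suc g1) (λ b → ind (does (a ≟ b)) x) (λ b → ind (not (does (a ≟ b))) x)) ⟩
    ∑ (suc g1) (λ b → ind (does (a ≟ b)) x + ind (not (does (a ≟ b))) x)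
  ≡⟨ ∑-cong (suc g1) _ _ (λ b → split (does (a ≟ b))) ⟩
    ∑ (suc g1) (λ _ → x)
  ≡⟨ ∑-const (suc g1) x ⟩
    x + g1 * x ∎)
  where
  split : ∀ c → ind c x + ind (not c) x ≡ x
  split true = +-identityʳ x
  split false = refl

∑∑-off-diagonal≡2*pairSum : ∀ k (f : Fin k → Fin k → ℕ) → (∀ i j → f i j ≡ f j i) →
   ∑ k (λ i → ∑ k (λ j → ind (not (does (i ≟ j))) (f i j))) ≡ 2 * pairSum k f
∑∑-off-diagonal≡2*pairSum k f sy = trans (∑∑≡2*pairSum+diagonal k f' sy') (trans (cong₂ _+_ (cong (2 *_) ps) (∑≡0 k _ (λ i → cong (λ b → ind (not b) (f i i)) (does-≟-refl i)))) (+-identityʳ _))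
  where
  f' : Fin k → Fin k → ℕ
  f' i j = ind (not (does (i ≟ j))) (f i j)
  sy' : ∀ i j → f' i j ≡ f' j i
  sy' i j = cong₂ (λ b z → ind (not b) z) (does-≟-sym i j) (sy i j)
  ps : pairSum k f' ≡ pairSum k f
  ps = ∑-cong k _ _ (λ i → ∑-cong k _ _ (λ j → h i j))
    where
    h : ∀ i j → ind (toℕ i <ᵇ toℕ j) (f' i j) ≡ ind (toℕ i <ᵇ toℕ j) (f i j)
    h i j with toℕ i <ᵇ toℕ j in e
    ... | false = refl
    ... | true rewrite does-≟-≢ i j (λ q → <⇒≢ (<ᵇ⇒< (toℕ i) (toℕ j) (subst Bool.T (sym e) _)) (cong toℕ q)) = refl

-- Reachability and distance

Fin⇒≡suc∸1 : ∀ {n} → Fin n → n ≡ suc (n ∸ 1)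
Fin⇒≡suc∸1 {suc n} _ = refl

notBit : Bool → ℕ
notBit b = if not b then 1 else 0

notBit≤1 : ∀ b → notBit b ≤ 1
notBit≤1 true = z≤n
notBit≤1 false = s≤s z≤n

∑ℕ≡0 : ∀ N (f : ℕ → ℕ) → (∀ t → f t ≡ 0) → ∑ℕ N f ≡ 0
∑ℕ≡0 zero f e = refl
∑ℕ≡0 (suc N) f e rewrite e 0 = ∑ℕ≡0 N _ (λ t → e (suc t))

∑ℕ-notBit≤ : ∀ N (q : ℕ → Bool) m → (∀ k → m ≤ k → q k ≡ true) → ∑ℕ N (λ t → notBit (q t)) ≤ m
∑ℕ-notBit≤ zero q m h = z≤n
∑ℕ-notBit≤ (suc N) q zero h rewrite h 0 z≤n = ∑ℕ-notBit≤ N (λ t → q (suc t)) 0 (λ k _ → h (suc k) z≤n)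
∑ℕ-notBit≤ (suc N) q (suc m) h = +-mono-≤ (notBit≤1 (q 0)) (∑ℕ-notBit≤ N (λ t → q (suc t)) m (λ k le → h (suc k) (s≤s le)))

true-upward : ∀ (q : ℕ → Bool) → (∀ k → q k ≡ true → q (suc k) ≡ true) → q 0 ≡ true → ∀ k → q k ≡ true
true-upward q mono h zero = h
true-upward q mono h (suc k) = mono k (true-upward q mono h k)

∑ℕ-notBit-true : ∀ N (q : ℕ → Bool) → (∀ k → q k ≡ true → q (suc k) ≡ true) → q N ≡ true →
      q (∑ℕ (suc N) (λ t → notBit (q t))) ≡ true
∑ℕ-notBit-true N q mono h with q 0 in e
... | true = subst (λ z → q z ≡ true) (sym (∑ℕ≡0 N _ (λ t → cong notBit (true-upward q mono e (suc t))))) e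
∑ℕ-notBit-true zero q mono h | false = ⊥-elim (true≢false (trans (sym h) e))
∑ℕ-notBit-true (suc N) q mono h | false = ∑ℕ-notBit-true N (λ t → q (suc t)) (λ k → mono (suc k)) h

Walk : ∀ {n} → Graph n → ℕ → (ℕ → Fin n) → Set
Walk A L p = ∀ t → t < L → A (p t) (p (suc t)) ≡ true

snocWalk : ∀ {n} → (ℕ → Fin n) → ℕ → Fin n → ℕ → Fin n
snocWalk p L y t = if t ≡ᵇ suc L then y else p t

snocWalk-≤ : ∀ {n} (p : ℕ → Fin n) L y t → t ≤ L → snocWalk p L y t ≡ p t
snocWalk-≤ p L y t le with t ≡ᵇ suc L in e
... | false = refl
... | true = ⊥-elim (<⇒≱ (s≤s le) (≤-reflexive (sym (≡ᵇ-true⇒≡ e))))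

snocWalk-last : ∀ {n} (p : ℕ → Fin n) L y → snocWalk p L y (suc L) ≡ y
snocWalk-last p L y rewrite ≡ᵇ-refl L = refl

repeats? : ∀ {n} (p : ℕ → Fin n) L → Dec (Σ ℕ λ s → Σ ℕ λ t → s < t × t ≤ L × p s ≡ p t)
repeats? p L with Finₚ.any? {n = suc L} (λ s → Finₚ.any? {n = suc L} (λ t → (toℕ s <? toℕ t) ×-dec (p (toℕ s) ≟ p (toℕ t))))
... | yes (s , t , lt , e) = yes (toℕ s , toℕ t , lt , ≤-pred (Finₚ.toℕ<n t) , e)
... | no nn = no h
  where
  h : ¬ (Σ ℕ λ s → Σ ℕ λ t → s < t × t ≤ L × p s ≡ p t)
  h (s , t , lt , tL , e) = nn (fromℕ< (s≤s (≤-trans (<⇒≤ lt) tL)) , fromℕ< (s≤s tL) , lt' , e')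
    where
    lt' : toℕ (fromℕ< (s≤s (≤-trans (<⇒≤ lt) tL))) < toℕ (fromℕ< {t} {suc L} (s≤s tL))
    lt' rewrite Finₚ.toℕ-fromℕ< (s≤s (≤-trans (<⇒≤ lt) tL)) | Finₚ.toℕ-fromℕ< {t} {suc L} (s≤s tL) = lt
    e' : p (toℕ (fromℕ< (s≤s (≤-trans (<⇒≤ lt) tL)))) ≡ p (toℕ (fromℕ< {t} {suc L} (s≤s tL)))
    e' rewrite Finₚ.toℕ-fromℕ< (s≤s (≤-trans (<⇒≤ lt) tL)) | Finₚ.toℕ-fromℕ< {t} {suc L} (s≤s tL) = e

module Reachability {n : ℕ} (A : Graph n) where

  reach-refl : ∀ x → reach A 0 x x ≡ true
  reach-refl x = does-≟-refl x

  reach0⇒≡ : ∀ {x y} → reach A 0 x y ≡ true → x ≡ y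
  reach0⇒≡ {x} {y} p = does-≟⇒≡ x y p

  reach-suc : ∀ k x y → reach A k x y ≡ true → reach A (suc k) x y ≡ true
  reach-suc k x y p = ∨-trueˡ _ _ p

  reach-step : ∀ k x w y → reach A k x w ≡ true → A w y ≡ true → reach A (suc k) x y ≡ true
  reach-step k x w y p q = ∨-trueʳ (reach A k x y) _ (anyF-true n _ w (∧-true p q))

  reach-suc⇒ : ∀ k x y → reach A (suc k) x y ≡ true →
           reach A k x y ≡ true ⊎ Σ (Fin n) (λ w → reach A k x w ≡ true × A w y ≡ true)
  reach-suc⇒ k x y p with ∨-true⇒ _ _ p
  ... | inj₁ q = inj₁ q
  ... | inj₂ q with anyF-true⇒ n _ q
  ... | w , r = inj₂ (w , ∧-true⇒ _ _ r)

  reach-mono+ : ∀ m k x y → reach A k x y ≡ true → reach A (m + k) x y ≡ true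
  reach-mono+ zero k x y p = p
  reach-mono+ (suc m) k x y p = reach-suc (m + k) x y (reach-mono+ m k x y p)

  reach-mono : ∀ {k k'} x y → k ≤ k' → reach A k x y ≡ true → reach A k' x y ≡ true
  reach-mono {k} {k'} x y le p = subst (λ z → reach A z x y ≡ true) (m∸n+n≡m le) (reach-mono+ (k' ∸ k) k x y p)

  reach-trans : ∀ a b x y z → reach A a x y ≡ true → reach A b y z ≡ true → reach A (a + b) x z ≡ true
  reach-trans a zero x y z p q with reach0⇒≡ {y} {z} q
  ... | refl = subst (λ t → reach A t x y ≡ true) (sym (+-identityʳ a)) p
  reach-trans a (suc b) x y z p q with reach-suc⇒ b y z q
  ... | inj₁ q' = subst (λ t → reach A t x z ≡ true) (sym (+-suc a b)) (reach-suc (a + b) x z (reach-trans a b x y z p q'))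
  ... | inj₂ (w , q1 , q2) = subst (λ t → reach A t x z ≡ true) (sym (+-suc a b)) (reach-step (a + b) x w z (reach-trans a b x y w p q1) q2)

  reach-edge : ∀ x y → A x y ≡ true → reach A 1 x y ≡ true
  reach-edge x y e = reach-step 0 x x y (reach-refl x) e

  Stable : Fin n → ℕ → Set
  Stable x j = ∀ w → reach A (suc j) x w ≡ reach A j x w

  stable-suc : ∀ x j → Stable x j → Stable x (suc j)
  stable-suc x j st w = cong₂ _∨_ (st w) (anyF-cong n _ _ (λ v → cong (_∧ A v w) (st v)))

  stable-+ : ∀ x j m → Stable x j → ∀ w → reach A (m + j) x w ≡ reach A j x w
  stable-+ x j zero st w = refl
  stable-+ x j (suc m) st w = trans (st' m w) (stable-+ x j m st w)
    where
    st' : ∀ m → Stable x (m + j)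
    st' zero = st
    st' (suc m) = stable-suc x (m + j) (st' m)

  stable-or-growing : ∀ x k → Σ ℕ (λ j → j < k × Stable x j) ⊎ suc k ≤ count n (reach A k x)
  stable-or-growing x zero = inj₂ (subst (λ z → suc z ≤ count n (reach A 0 x)) (∑≡0 n _ (λ _ → refl)) (count-< n (λ _ → false) (reach A 0 x) (λ _ ()) x (reach-refl x) refl))
  stable-or-growing x (suc k) with stable-or-growing x k
  ... | inj₁ (j , lt , st) = inj₁ (j , m≤n⇒m≤1+n lt , st)
  ... | inj₂ cnt with anyF n (λ w → reach A (suc k) x w ∧ not (reach A k x w)) in eq
  ... | true with anyF-true⇒ n _ eq
  ... | w , e with ∧-true⇒ _ _ e
  ... | e1 , e2 = inj₂ (≤-trans (s≤s cnt) (count-< n (reach A k x) (reach A (suc k) x) (λ v → reach-suc k x v) w e1 (notT e2)))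
    where
    notT : ∀ {b} → not b ≡ true → b ≡ false
    notT {false} _ = refl
  stable-or-growing x (suc k) | inj₂ cnt | false = inj₁ (k , ≤-refl , st)
    where
    st : Stable x k
    st w with reach A k x w in e0 | anyF-false⇒ n _ eq w
    ... | true | _ = refl
    ... | false | h = ∧t h
      where
      ∧t : ∀ {b} → b ∧ true ≡ false → b ≡ false
      ∧t {false} _ = refl

  -- Pigeonhole: unless the reachable set stabilises before step n, it grows at each of the
  -- first n steps.
  reach-≤n∸1 : ∀ m x y → reach A m x y ≡ true → reach A (n ∸ 1) x y ≡ true
  reach-≤n∸1 m x y p with m ≤? (n ∸ 1)
  ... | yes le = reach-mono x y le p
  ... | no gt with stable-or-growing x n
  ... | inj₂ c = ⊥-elim (<⇒≱ c (count≤ n _))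
  ... | inj₁ (j , j<n , st) = reach-mono x y jle' rj
    where
    jle' : j ≤ n ∸ 1
    jle' = subst (j ≤_) (pred[m∸n]≡m∸[1+n] n 0) (<⇒≤pred j<n)
    jle : j ≤ m
    jle = ≤-trans jle' (<⇒≤ (≰⇒> gt))
    rj : reach A j x y ≡ true
    rj = trans (sym (stable-+ x j (m ∸ j) st y)) (subst (λ t → reach A t x y ≡ true) (sym (m∸n+n≡m jle)) p)

  reach-⊆ : (B : Graph n) → (∀ x y → A x y ≡ true → B x y ≡ true) → ∀ k x y → reach A k x y ≡ true → reach B k x y ≡ true
  reach-⊆ B h zero x y p = p
  reach-⊆ B h (suc k) x y p with reach-suc⇒ k x y p
  ... | inj₁ q = ∨-trueˡ _ _ (reach-⊆ B h k x y q)
  ... | inj₂ (w , q1 , q2) = ∨-trueʳ (reach B k x y) _ (anyF-true n _ w (∧-true (reach-⊆ B h k x w q1) (h w y q2)))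

  dist≤ : ∀ m x y → reach A m x y ≡ true → dist A x y ≤ m
  dist≤ m x y p = subst (_≤ m) (sym (∑-toℕ n (λ t → notBit (reach A t x y))))
                      (∑ℕ-notBit≤ n (λ t → reach A t x y) m (λ k le → reach-mono x y le p))

  reach-dist : ∀ m x y → reach A m x y ≡ true → reach A (dist A x y) x y ≡ true
  reach-dist m x y p = subst (λ z → reach A z x y ≡ true) (sym eq) (∑ℕ-notBit-true (n ∸ 1) (λ t → reach A t x y) (λ k → reach-suc k x y) (reach-≤n∸1 m x y p))
    where
    eq : dist A x y ≡ ∑ℕ (suc (n ∸ 1)) (λ t → notBit (reach A t x y))
    eq = trans (∑-toℕ n (λ t → notBit (reach A t x y))) (cong (λ z → ∑ℕ z (λ t → notBit (reach A t x y))) (Fin⇒≡suc∸1 x))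

  dist-self : ∀ x → dist A x x ≡ 0
  dist-self x = n≤0⇒n≡0 (dist≤ 0 x x (reach-refl x))

  dist-edge≤1 : ∀ x y → A x y ≡ true → dist A x y ≤ 1
  dist-edge≤1 x y e = dist≤ 1 x y (reach-edge x y e)

  dist-tri : ∀ a b x y z → reach A a x y ≡ true → reach A b y z ≡ true → dist A x z ≤ dist A x y + dist A y z
  dist-tri a b x y z p q = dist≤ _ x z (reach-trans (dist A x y) (dist A y z) x y z (reach-dist a x y p) (reach-dist b y z q))

  potential≤ : ∀ x (pot : Fin n → ℕ) → pot x ≡ 0 → (∀ w y → A w y ≡ true → pot y ≤ suc (pot w)) →
           ∀ m y → reach A m x y ≡ true → pot y ≤ m
  potential≤ x pot d0 st zero y p with reach0⇒≡ {x} {y} p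
  ... | refl = ≤-reflexive d0
  potential≤ x pot d0 st (suc m) y p with reach-suc⇒ m x y p
  ... | inj₁ q = m≤n⇒m≤1+n (potential≤ x pot d0 st m y q)
  ... | inj₂ (w , q1 , q2) = ≤-trans (st w y q2) (s≤s (potential≤ x pot d0 st m w q1))

  dist≡potential : ∀ x y (pot : Fin n → ℕ) → pot x ≡ 0 → (∀ w z → A w z ≡ true → pot z ≤ suc (pot w)) →
               reach A (pot y) x y ≡ true → dist A x y ≡ pot y
  dist≡potential x y pot d0 st r = ≤-antisym (dist≤ (pot y) x y r) (potential≤ x pot d0 st (dist A x y) y (reach-dist (pot y) x y r))

  reach→walk : ∀ k x y → reach A k x y ≡ true →
     Σ ℕ λ L → Σ (ℕ → Fin n) λ p → L ≤ k × p 0 ≡ x × p L ≡ y × Walk A L p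
  reach→walk zero x y r with reach0⇒≡ {x} {y} r
  ... | refl = 0 , (λ _ → x) , z≤n , refl , refl , (λ t ())
  reach→walk (suc k) x y r with reach-suc⇒ k x y r
  ... | inj₁ q with reach→walk k x y q
  ... | L , p , le , e0 , eL , wk = L , p , m≤n⇒m≤1+n le , e0 , eL , wk
  reach→walk (suc k) x y r | inj₂ (w , q1 , q2) with reach→walk k x w q1
  ... | L , p , le , e0 , eL , wk = suc L , snocWalk p L y , s≤s le , trans (snocWalk-≤ p L y 0 z≤n) e0 , snocWalk-last p L y , wk'
    where
    wk' : Walk A (suc L) (snocWalk p L y)
    wk' t (s≤s t≤L) with m≤n⇒m<n∨m≡n t≤L
    ... | inj₁ t<L rewrite snocWalk-≤ p L y t t≤L | snocWalk-≤ p L y (suc t) t<L = wk t t<L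
    ... | inj₂ refl rewrite snocWalk-≤ p L y t t≤L | snocWalk-last p L y | eL = q2

  shortcut-walk : ∀ (p : ℕ → Fin n) s t L → s < t → t ≤ L → p s ≡ p t → Walk A L p →
     Σ (ℕ → Fin n) λ q → Σ ℕ λ L' → L' < L × Walk A L' q × q 0 ≡ p 0 × q L' ≡ p L
  shortcut-walk p s t L st tL eq wk with m≤n⇒∃[o]m+o≡n (<⇒≤ st) | m≤n⇒∃[o]m+o≡n tL
  ... | d , refl | r , refl = q , s + r , lt , wq , qlo 0 z≤n , trans (qhi (s + r) (m≤m+n s r)) (cong p eqn)
    where
    q : ℕ → Fin n
    q m = if m ≤ᵇ s then p m else p (m + d)
    qlo : ∀ m → m ≤ s → q m ≡ p m
    qlo m le rewrite ≤⇒≤ᵇ-true le = refl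
    qhi : ∀ m → s ≤ m → q m ≡ p (m + d)
    qhi m le with m ≤ᵇ s in e
    ... | false = refl
    ... | true with ≤-antisym (≤ᵇ⇒≤ m s (subst Bool.T (sym e) _)) le
    ... | refl = eq
    eqn : s + r + d ≡ s + d + r
    eqn = solve 3 (λ s r d → s :+ r :+ d := s :+ d :+ r) refl s r d
    lt : s + r < s + d + r
    lt = +-monoˡ-< r st
    wq : Walk A (s + r) q
    wq m ml with m <? s
    ... | yes ms rewrite qlo m (<⇒≤ ms) | qlo (suc m) ms = wk m (≤-trans ms (≤-trans (m≤m+n s d) (m≤m+n (s + d) r)))
    ... | no nms rewrite qhi m (≮⇒≥ nms) | qhi (suc m) (m≤n⇒m≤1+n (≮⇒≥ nms)) =
          wk (m + d) (subst (m + d <_) eqn (+-monoˡ-< d ml))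

  suffix-walk : ∀ L p s r → s + r ≡ L → Walk A L p → Walk A r (λ m → p (s + m))
  suffix-walk L p s r e wk m mr rewrite +-suc s m = wk (s + m) (subst (s + m <_) e (+-monoʳ-< s mr))

module SymmetricReachability {n : ℕ} (A : Graph n) (symA : ∀ x y → A x y ≡ A y x) where
  open Reachability A

  reverse-walk : ∀ L p → Walk A L p → Walk A L (λ m → p (L ∸ m))
  reverse-walk L p wk m ml rewrite +-∸-assoc 1 ml = trans (symA _ _) (wk (L ∸ suc m) bnd)
    where
    bnd : L ∸ suc m < L
    bnd = ≤-trans (≤-reflexive (sym (+-∸-assoc 1 ml))) (m∸n≤m L m)

  reach-sym : ∀ k x y → reach A k x y ≡ true → reach A k y x ≡ true
  reach-sym zero x y p with reach0⇒≡ {x} {y} p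
  ... | refl = p
  reach-sym (suc k) x y p with reach-suc⇒ k x y p
  ... | inj₁ q = reach-suc k y x (reach-sym k x y q)
  ... | inj₂ (w , q1 , q2) = reach-trans 1 k y w x (reach-edge y w (trans (symA y w) q2)) (reach-sym k x w q1)

  dist-sym : ∀ m x y → reach A m x y ≡ true → dist A x y ≡ dist A y x
  dist-sym m x y p = ≤-antisym (dist≤ (dist A y x) x y (reach-sym (dist A y x) y x (reach-dist m y x (reach-sym m x y p))))
                               (dist≤ (dist A x y) y x (reach-sym (dist A x y) x y (reach-dist m x y p)))

-- Distances on a cycle

-- arcMin g d is the distance on C_g between two vertices d steps apart (d ≤ g).
arcMin : ℕ → ℕ → ℕ
arcMin g d = d ⊓ (g ∸ d)

∸≤suc-∸suc : ∀ g d → g ∸ d ≤ suc (g ∸ suc d)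
∸≤suc-∸suc zero d = subst (_≤ 1) (sym (0∸n≡0 d)) z≤n
∸≤suc-∸suc (suc g) zero = s≤s (≤-reflexive refl)
∸≤suc-∸suc (suc g) (suc d) = ∸≤suc-∸suc g d

arcMin-suc≤ : ∀ g d → arcMin g (suc d) ≤ suc (arcMin g d)
arcMin-suc≤ g d = ⊓-mono-≤ (≤-refl {suc d}) (≤-trans (∸-monoʳ-≤ g (n≤1+n d)) (n≤1+n _))

arcMin≤suc : ∀ g d → arcMin g d ≤ suc (arcMin g (suc d))
arcMin≤suc g d = ⊓-mono-≤ (≤-trans (n≤1+n d) (n≤1+n _)) (∸≤suc-∸suc g d)

∑ℕ-cong : ∀ p (f h : ℕ → ℕ) → (∀ t → t < p → f t ≡ h t) → ∑ℕ p f ≡ ∑ℕ p h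
∑ℕ-cong zero f h e = refl
∑ℕ-cong (suc p) f h e = cong₂ _+_ (e 0 (s≤s z≤n)) (∑ℕ-cong p _ _ (λ t lt → e (suc t) (s≤s lt)))

∑ℕ-+ : ∀ p q (f : ℕ → ℕ) → ∑ℕ (p + q) f ≡ ∑ℕ p f + ∑ℕ q (λ t → f (p + t))
∑ℕ-+ zero q f = refl
∑ℕ-+ (suc p) q f = trans (cong (f 0 +_) (∑ℕ-+ p q (λ t → f (suc t)))) (sym (+-assoc (f 0) _ _))

∑ℕ-snoc : ∀ p (f : ℕ → ℕ) → ∑ℕ (suc p) f ≡ ∑ℕ p f + f p
∑ℕ-snoc zero f = +-identityʳ (f 0)
∑ℕ-snoc (suc p) f = trans (cong (f 0 +_) (∑ℕ-snoc p (λ t → f (suc t)))) (sym (+-assoc (f 0) _ _))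

∑ℕ-suc : ∀ p (f : ℕ → ℕ) → ∑ℕ p (λ t → suc (f t)) ≡ p + ∑ℕ p f
∑ℕ-suc zero f = refl
∑ℕ-suc (suc p) f = cong suc (trans (cong (f 0 +_) (∑ℕ-suc p (λ t → f (suc t)))) (+-left-comm (f 0) p _))

∑arcMin : ℕ → ℕ
∑arcMin g = ∑ℕ g (arcMin g)

∑arcMin-suc-suc : ∀ g → ∑arcMin (suc (suc g)) ≡ suc g + ∑arcMin g
∑arcMin-suc-suc g = begin
    ∑ℕ (suc g) (λ s → arcMin (suc (suc g)) (suc s))
  ≡⟨ ∑ℕ-cong (suc g) _ _ (λ s lt → cong (suc s ⊓_) (+-∸-assoc 1 (≤-pred lt))) ⟩
    ∑ℕ (suc g) (λ s → suc (arcMin g s))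
  ≡⟨ ∑ℕ-suc (suc g) (arcMin g) ⟩
    suc g + ∑ℕ (suc g) (arcMin g)
  ≡⟨ cong (suc g +_) (∑ℕ-snoc g (arcMin g)) ⟩
    suc g + (∑arcMin g + arcMin g g)
  ≡⟨ cong (λ z → suc g + (∑arcMin g + z)) (trans (cong (g ⊓_) (n∸n≡0 g)) (⊓-zeroʳ g)) ⟩
    suc g + (∑arcMin g + 0)
  ≡⟨ cong (suc g +_) (+-identityʳ _) ⟩
    suc g + ∑arcMin g ∎

sq-suc-suc : ∀ g → suc (suc g) * suc (suc g) ≡ suc g * 4 + g * g
sq-suc-suc = solve 1 (λ g → (con 2 :+ g) :* (con 2 :+ g) := (con 1 :+ g) :* con 4 :+ g :* g) refl

⌊sq/4⌋-suc-suc : ∀ g → (suc (suc g) * suc (suc g)) / 4 ≡ suc g + (g * g) / 4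
⌊sq/4⌋-suc-suc g = trans (cong (_/ 4) (sq-suc-suc g)) (trans (+-distrib-/-∣ˡ {suc g * 4} (g * g) {4} (divides-refl (suc g))) (cong (_+ (g * g) / 4) (m*n/n≡m (suc g) 4)))

∑arcMin≡⌊g²/4⌋ : ∀ g → ∑arcMin g ≡ (g * g) / 4
∑arcMin≡⌊g²/4⌋ zero = refl
∑arcMin≡⌊g²/4⌋ (suc zero) = refl
∑arcMin≡⌊g²/4⌋ (suc (suc g)) = trans (∑arcMin-suc-suc g) (trans (cong (suc g +_) (∑arcMin≡⌊g²/4⌋ g)) (sym (⌊sq/4⌋-suc-suc g)))

clamp : ∀ g1 → ℕ → Fin (suc g1)
clamp g1 zero = zero
clamp zero (suc m) = zero
clamp (suc g1) (suc m) = suc (clamp g1 m)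

toℕ-clamp : ∀ g1 m → m ≤ g1 → toℕ (clamp g1 m) ≡ m
toℕ-clamp g1 zero le = refl
toℕ-clamp (suc g1) (suc m) (s≤s le) = cong suc (toℕ-clamp g1 m le)

clamp-toℕ : ∀ g1 (a : Fin (suc g1)) → clamp g1 (toℕ a) ≡ a
clamp-toℕ g1 zero = refl
clamp-toℕ (suc g1) (suc a) = cong suc (clamp-toℕ g1 a)

toℕ≤ : ∀ g1 (a : Fin (suc g1)) → toℕ a ≤ g1
toℕ≤ g1 a = ≤-pred (Finₚ.toℕ<n a)

CycSuccℕ : ℕ → ℕ → ℕ → Set
CycSuccℕ g1 β β' = (suc β ≡ β') ⊎ (β ≡ g1 × β' ≡ 0)

cycSucc-intro : ∀ g1 (a b : Fin (suc g1)) → CycSuccℕ g1 (toℕ a) (toℕ b) → cycSucc (suc g1) a b ≡ true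
cycSucc-intro g1 a b (inj₁ q) = ∨-trueˡ _ _ (≡⇒≡ᵇ-true q)
cycSucc-intro g1 a b (inj₂ (q1 , q2)) = ∨-trueʳ (suc (toℕ a) ≡ᵇ toℕ b) _ (∧-true (≡⇒≡ᵇ-true q1) (≡⇒≡ᵇ-true q2))

cycSucc⇒ : ∀ k (i j : Fin k) → cycSucc k i j ≡ true → CycSuccℕ (k ∸ 1) (toℕ i) (toℕ j)
cycSucc⇒ k i j p with ∨-true⇒ _ _ p
... | inj₁ q = inj₁ (≡ᵇ-true⇒≡ q)
... | inj₂ q with ∧-true⇒ _ _ q
... | q1 , q2 = inj₂ (≡ᵇ-true⇒≡ q1 , ≡ᵇ-true⇒≡ q2)

cycAdj-edge : ∀ {n} k (c : Fin k → Fin n) i j → cycSucc k i j ≡ true → cycAdj k c (c i) (c j) ≡ true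
cycAdj-edge k c a b p = anyF-true k (λ i → anyF k (λ j → cycSucc k i j ∧ sameEnds i j)) a
                 (anyF-true k (λ j → cycSucc k a j ∧ sameEnds a j) b (∧-true p (∨-trueˡ _ _ (∧-true (does-≟-refl (c a)) (does-≟-refl (c b))))))
    where
    sameEnds : Fin k → Fin k → Bool
    sameEnds i j = (does (c a ≟ c i) ∧ does (c b ≟ c j)) ∨ (does (c a ≟ c j) ∧ does (c b ≟ c i))

module Cycle {n g1 : ℕ} (u : Fin (suc g1) → Fin n) (uinj : Injective _≡_ _≡_ u) where
  g : ℕ
  g = suc g1

  C : Graph n
  C = cycAdj g u

  -- Indices are clamped to g − 1, so uℕ is meaningful only below g.
  uℕ : ℕ → Fin n
  uℕ m = u (clamp g1 m)

  uℕ-toℕ : ∀ a → uℕ (toℕ a) ≡ u a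
  uℕ-toℕ a = cong u (clamp-toℕ g1 a)

  uℕ-injective : ∀ β β' → β ≤ g1 → β' ≤ g1 → uℕ β ≡ uℕ β' → β ≡ β'
  uℕ-injective β β' l l' e = trans (sym (toℕ-clamp g1 β l)) (trans (cong toℕ (uinj e)) (toℕ-clamp g1 β' l'))

  C-sym : ∀ x y → C x y ≡ C y x
  C-sym x y = anyF-cong g _ _ (λ i → anyF-cong g _ _ (λ j → cong (cycSucc g i j ∧_)
                (∨∧-swap (does (x ≟ u i)) (does (y ≟ u j)) (does (x ≟ u j)) (does (y ≟ u i)))))

  C-edge⇒ : ∀ x y → C x y ≡ true → Σ (Fin g) λ a → Σ (Fin g) λ b → x ≡ u a × y ≡ u b × (cycSucc g a b ≡ true ⊎ cycSucc g b a ≡ true)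
  C-edge⇒ x y p with anyF-true⇒ g _ p
  ... | i , q with anyF-true⇒ g _ q
  ... | j , r with ∧-true⇒ _ _ r
  ... | r1 , r2 with ∨-true⇒ _ _ r2
  ... | inj₁ s with ∧-true⇒ _ _ s
  ... | s1 , s2 = i , j , does-≟⇒≡ _ _ s1 , does-≟⇒≡ _ _ s2 , inj₁ r1
  C-edge⇒ x y p | i , q | j , r | r1 , r2 | inj₂ s with ∧-true⇒ _ _ s
  ... | s1 , s2 = j , i , does-≟⇒≡ _ _ s1 , does-≟⇒≡ _ _ s2 , inj₂ r1

  Adj : ℕ → ℕ → Set
  Adj β β' = CycSuccℕ g1 β β' ⊎ CycSuccℕ g1 β' β

  C-edge⇒ℕ : ∀ x y → C x y ≡ true → Σ ℕ λ β → Σ ℕ λ β' → β ≤ g1 × β' ≤ g1 × x ≡ uℕ β × y ≡ uℕ β' × Adj β β'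
  C-edge⇒ℕ x y p with C-edge⇒ x y p
  ... | a , b , ea , eb , s = toℕ a , toℕ b , toℕ≤ g1 a , toℕ≤ g1 b ,
        trans ea (sym (uℕ-toℕ a)) , trans eb (sym (uℕ-toℕ b)) , h s
    where
    h : (cycSucc g a b ≡ true ⊎ cycSucc g b a ≡ true) → Adj (toℕ a) (toℕ b)
    h (inj₁ q) = inj₁ (cycSucc⇒ g a b q)
    h (inj₂ q) = inj₂ (cycSucc⇒ g b a q)

  C-edgeℕ : ∀ β β' → β ≤ g1 → β' ≤ g1 → CycSuccℕ g1 β β' → C (uℕ β) (uℕ β') ≡ true
  C-edgeℕ β β' l l' s = cycAdj-edge g u (clamp g1 β) (clamp g1 β') (cycSucc-intro g1 _ _ (subst₂ (CycSuccℕ g1) (sym (toℕ-clamp g1 β l)) (sym (toℕ-clamp g1 β' l')) s))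

  open Reachability C
  open SymmetricReachability C C-sym

  reach-forward : ∀ d α → α + d ≤ g1 → reach C d (uℕ α) (uℕ (α + d)) ≡ true
  reach-forward zero α le = subst (λ z → reach C 0 (uℕ α) (uℕ z) ≡ true) (sym (+-identityʳ α)) (reach-refl (uℕ α))
  reach-forward (suc d) α le = subst (λ z → reach C (suc d) (uℕ α) (uℕ z) ≡ true) (sym (+-suc α d))
     (reach-step d (uℕ α) (uℕ (α + d)) (uℕ (suc (α + d))) (reach-forward d α (≤-trans (+-monoʳ-≤ α (n≤1+n d)) le))
       (C-edgeℕ (α + d) (suc (α + d)) (≤-trans (+-monoʳ-≤ α (n≤1+n d)) le) (subst (_≤ g1) (+-suc α d) le) (inj₁ refl)))

  reach-wrap : ∀ α γ → α ≤ g1 → γ ≤ g1 → reach C ((g1 ∸ α) + suc γ) (uℕ α) (uℕ γ) ≡ true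
  reach-wrap α γ l l' = reach-trans (g1 ∸ α) (suc γ) (uℕ α) (uℕ g1) (uℕ γ)
     (subst (λ z → reach C (g1 ∸ α) (uℕ α) (uℕ z) ≡ true) (m+[n∸m]≡n l) (reach-forward (g1 ∸ α) α (≤-reflexive (m+[n∸m]≡n l))))
     (reach-trans 1 γ (uℕ g1) (uℕ 0) (uℕ γ) (reach-edge (uℕ g1) (uℕ 0) (C-edgeℕ g1 0 ≤-refl z≤n (inj₂ (refl , refl)))) (reach-forward γ 0 l'))

  arcDist : ℕ → ℕ → ℕ
  arcDist α β = if α ≤ᵇ β then arcMin g (β ∸ α) else arcMin g ((g ∸ α) + β)

  arcDist-≤ : ∀ α β → α ≤ β → arcDist α β ≡ arcMin g (β ∸ α)
  arcDist-≤ α β le with α ≤ᵇ β in e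
  ... | true = refl
  ... | false = ⊥-elim (subst Bool.T e (≤⇒≤ᵇ le))

  arcDist-> : ∀ α β → β < α → arcDist α β ≡ arcMin g ((g ∸ α) + β)
  arcDist-> α β lt with α ≤ᵇ β in e
  ... | true = ⊥-elim (<⇒≱ lt (≤ᵇ⇒≤ α β (subst Bool.T (sym e) _)))
  ... | false = refl

  arcMin-g∸1≤1 : arcMin g g1 ≤ 1
  arcMin-g∸1≤1 = ≤-trans (m⊓n≤n g1 (suc g1 ∸ g1)) (≤-reflexive (m+n∸n≡m 1 g1))

  wrapLength≡g∸arc : ∀ α β → α ≤ β → β ≤ g1 → (g1 ∸ β) + suc α ≡ suc g1 ∸ (β ∸ α)
  wrapLength≡g∸arc α β l1 l2 with m≤n⇒∃[o]m+o≡n l1 | m≤n⇒∃[o]m+o≡n l2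
  ... | b , refl | e , refl rewrite m+n∸m≡n (α + b) e | m+n∸m≡n α b =
        trans (+-comm e (suc α)) (sym (trans (cong (_∸ b) (eqs α b e)) (m+n∸n≡m (suc α + e) b)))
    where
    eqs : ∀ α b e → suc (α + b + e) ≡ suc α + e + b
    eqs = solve 3 (λ α b e → con 1 :+ (α :+ b :+ e) := con 1 :+ α :+ e :+ b) refl

  wrapLength-suc : ∀ α β → α ≤ g1 → (g1 ∸ α) + suc β ≡ (suc g1 ∸ α) + β
  wrapLength-suc α β l = trans (+-suc (g1 ∸ α) β) (cong (_+ β) (sym (+-∸-assoc 1 l)))

  arc≡g∸wrapLength : ∀ α β → β < α → α ≤ g1 → α ∸ β ≡ suc g1 ∸ ((suc g1 ∸ α) + β)
  arc≡g∸wrapLength α β l1 l2 with m≤n⇒∃[o]m+o≡n (<⇒≤ l1) | m≤n⇒∃[o]m+o≡n l2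
  ... | s , refl | e , refl rewrite m+n∸m≡n β s | +-∸-assoc 1 (m≤m+n (β + s) e) | m+n∸m≡n (β + s) e =
        sym (trans (cong (_∸ (suc e + β)) (eqs β s e)) (m+n∸n≡m s (suc e + β)))
    where
    eqs : ∀ β s e → suc (β + s + e) ≡ s + (suc e + β)
    eqs = solve 3 (λ β s e → con 1 :+ (β :+ s :+ e) := s :+ (con 1 :+ e :+ β)) refl

  reach-arcMin : ∀ D X Y → reach C D X Y ≡ true → reach C (g ∸ D) Y X ≡ true → reach C (arcMin g D) X Y ≡ true
  reach-arcMin D X Y p q with ⊓-sel D (g ∸ D)
  ... | inj₁ e = subst (λ z → reach C z X Y ≡ true) (sym e) p
  ... | inj₂ e = subst (λ z → reach C z X Y ≡ true) (sym e) (reach-sym (g ∸ D) Y X q)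

  reach-arcDist : ∀ α β → α ≤ g1 → β ≤ g1 → reach C (arcDist α β) (uℕ α) (uℕ β) ≡ true
  reach-arcDist α β l l' with α ≤? β
  ... | yes le rewrite arcDist-≤ α β le = reach-arcMin (β ∸ α) (uℕ α) (uℕ β)
        (subst (λ z → reach C (β ∸ α) (uℕ α) (uℕ z) ≡ true) (m+[n∸m]≡n le) (reach-forward (β ∸ α) α (subst (_≤ g1) (sym (m+[n∸m]≡n le)) l')))
        (subst (λ z → reach C z (uℕ β) (uℕ α) ≡ true) (wrapLength≡g∸arc α β le l') (reach-wrap β α l' l))
  ... | no nle rewrite arcDist-> α β (≰⇒> nle) = reach-arcMin ((g ∸ α) + β) (uℕ α) (uℕ β)
        (subst (λ z → reach C z (uℕ α) (uℕ β) ≡ true) (wrapLength-suc α β l) (reach-wrap α β l l'))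
        (subst (λ z → reach C z (uℕ β) (uℕ α) ≡ true) (arc≡g∸wrapLength α β (≰⇒> nle) l)
          (subst (λ z → reach C (α ∸ β) (uℕ β) (uℕ z) ≡ true) (m+[n∸m]≡n (<⇒≤ (≰⇒> nle))) (reach-forward (α ∸ β) β (subst (_≤ g1) (sym (m+[n∸m]≡n (<⇒≤ (≰⇒> nle)))) l))))

  arcDist-self : ∀ α → arcDist α α ≡ 0
  arcDist-self α = trans (arcDist-≤ α α ≤-refl) (cong (arcMin g) (n∸n≡0 α))

  arcMin-step : ∀ a b → a ≡ suc b → arcMin g a ≤ suc (arcMin g b) × arcMin g b ≤ suc (arcMin g a)
  arcMin-step a b refl = arcMin-suc≤ g b , arcMin≤suc g b

  arcDist-step : ∀ α β β' → α ≤ g1 → β ≤ g1 → β' ≤ g1 → CycSuccℕ g1 β β' → arcDist α β' ≤ suc (arcDist α β) × arcDist α β ≤ suc (arcDist α β')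
  arcDist-step α β .(suc β) l lb lb' (inj₁ refl) with <-cmp α (suc β)
  ... | tri< lt _ _ rewrite arcDist-≤ α β (≤-pred lt) | arcDist-≤ α (suc β) (<⇒≤ lt) = arcMin-step _ _ (+-∸-assoc 1 (≤-pred lt))
  ... | tri≈ _ refl _ rewrite arcDist-self (suc β) | arcDist-> (suc β) β ≤-refl | m∸n+n≡m lb = z≤n , ≤-trans arcMin-g∸1≤1 ≤-refl
  ... | tri> _ _ gt rewrite arcDist-> α β (<-trans (n<1+n β) gt) | arcDist-> α (suc β) gt =
        arcMin-step _ _ (+-suc (g ∸ α) β)
  arcDist-step zero β β' l lb lb' (inj₂ (refl , refl)) rewrite arcDist-self 0 | arcDist-≤ 0 g1 z≤n = z≤n , arcMin-g∸1≤1
  arcDist-step (suc α) β β' l lb lb' (inj₂ (refl , refl)) rewrite arcDist-> (suc α) 0 (s≤s z≤n) | arcDist-≤ (suc α) g1 l | +-identityʳ (g1 ∸ α) =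
        arcMin-step _ _ (+-∸-assoc 1 l)

  arcDist≤reach : ∀ m α y → α ≤ g1 → reach C m (uℕ α) y ≡ true → Σ ℕ λ β → β ≤ g1 × y ≡ uℕ β × arcDist α β ≤ m
  arcDist≤reach zero α y l p with reach0⇒≡ {uℕ α} {y} p
  ... | refl = α , l , refl , ≤-reflexive (arcDist-self α)
  arcDist≤reach (suc m) α y l p with reach-suc⇒ m (uℕ α) y p
  ... | inj₁ q with arcDist≤reach m α y l q
  ... | β , lb , e , c = β , lb , e , m≤n⇒m≤1+n c
  arcDist≤reach (suc m) α y l p | inj₂ (w , q1 , q2) with arcDist≤reach m α w l q1 | C-edge⇒ℕ w y q2
  ... | β , lb , e , c | γ , γ' , lg , lg' , ew , ey , adj with uℕ-injective β γ lb lg (trans (sym e) ew)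
  ... | refl = γ' , lg' , ey , ≤-trans (h adj) (s≤s c)
    where
    h : Adj β γ' → arcDist α γ' ≤ suc (arcDist α β)
    h (inj₁ s) = proj₁ (arcDist-step α β γ' l lb lg' s)
    h (inj₂ s) = proj₂ (arcDist-step α γ' β l lg' lb s)

  dist-C≡arcDist : ∀ a b → dist C (u a) (u b) ≡ arcDist (toℕ a) (toℕ b)
  dist-C≡arcDist a b = subst₂ (λ x y → dist C x y ≡ arcDist α β) (uℕ-toℕ a) (uℕ-toℕ b) dist≡arc
    where
    α = toℕ a
    β = toℕ b
    la = toℕ≤ g1 a
    lb = toℕ≤ g1 b
    reach-arc : reach C (arcDist α β) (uℕ α) (uℕ β) ≡ true
    reach-arc = reach-arcDist α β la lb
    dist≡arc : dist C (uℕ α) (uℕ β) ≡ arcDist α β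
    dist≡arc with arcDist≤reach (dist C (uℕ α) (uℕ β)) α (uℕ β) la (reach-dist (arcDist α β) (uℕ α) (uℕ β) reach-arc)
    ... | β₀ , l0 , e0 , c0 with uℕ-injective β β₀ lb l0 e0
    ... | refl = ≤-antisym (dist≤ (arcDist α β) (uℕ α) (uℕ β) reach-arc) c0

  ∑-dist-C≡⌊g²/4⌋ : ∀ a → ∑ g (λ b → dist C (u a) (u b)) ≡ (g * g) / 4
  ∑-dist-C≡⌊g²/4⌋ a = begin
      ∑ g (λ b → dist C (u a) (u b))
    ≡⟨ ∑-cong g _ _ (dist-C≡arcDist a) ⟩
      ∑ g (λ b → arcDist α (toℕ b))
    ≡⟨ ∑-toℕ g (arcDist α) ⟩
      ∑ℕ g (arcDist α)
    ≡⟨ cong (λ z → ∑ℕ z (arcDist α)) (sym (m+[n∸m]≡n la')) ⟩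
      ∑ℕ (α + (g ∸ α)) (arcDist α)
    ≡⟨ ∑ℕ-+ α (g ∸ α) (arcDist α) ⟩
      ∑ℕ α (arcDist α) + ∑ℕ (g ∸ α) (λ t → arcDist α (α + t))
    ≡⟨ cong₂ _+_ (∑ℕ-cong α _ _ (λ t lt → arcDist-> α t lt)) (∑ℕ-cong (g ∸ α) _ _ (λ t _ → trans (arcDist-≤ α (α + t) (m≤m+n α t)) (cong (arcMin g) (m+n∸m≡n α t)))) ⟩
      ∑ℕ α (λ t → arcMin g ((g ∸ α) + t)) + ∑ℕ (g ∸ α) (arcMin g)
    ≡⟨ +-comm (∑ℕ α (λ t → arcMin g ((g ∸ α) + t))) _ ⟩
      ∑ℕ (g ∸ α) (arcMin g) + ∑ℕ α (λ t → arcMin g ((g ∸ α) + t))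
    ≡⟨ sym (∑ℕ-+ (g ∸ α) α (arcMin g)) ⟩
      ∑ℕ ((g ∸ α) + α) (arcMin g)
    ≡⟨ cong (λ z → ∑ℕ z (arcMin g)) (m∸n+n≡m la') ⟩
      ∑arcMin g
    ≡⟨ ∑arcMin≡⌊g²/4⌋ g ⟩
      (g * g) / 4 ∎
    where
    α = toℕ a
    la' : α ≤ g
    la' = <⇒≤ (Finₚ.toℕ<n a)

cycAdj-first-edge : ∀ {n} k (c : Fin k → Fin n) → 3 ≤ k → (x y : Fin n) → (∀ i → toℕ i ≡ 0 → c i ≡ x) → (∀ i → toℕ i ≡ 1 → c i ≡ y) → cycAdj k c x y ≡ true
cycAdj-first-edge zero c () x y h0 h1
cycAdj-first-edge (suc zero) c (s≤s ()) x y h0 h1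
cycAdj-first-edge (suc (suc zero)) c (s≤s (s≤s ())) x y h0 h1
cycAdj-first-edge (suc (suc (suc k'))) c _ x y h0 h1 with h0 zero refl | h1 (suc zero) refl
... | refl | refl = cycAdj-edge _ c zero (suc zero) refl

3≤cycle-length : ∀ L δ → L ≢ 0 → (L ≡ 1 → δ ≡ 0 → ⊥) → 3 ≤ L + suc δ
3≤cycle-length zero δ h1 h2 = ⊥-elim (h1 refl)
3≤cycle-length (suc zero) zero h1 h2 = ⊥-elim (h2 refl refl)
3≤cycle-length (suc zero) (suc δ) h1 h2 = s≤s (s≤s (s≤s z≤n))
3≤cycle-length (suc (suc L)) δ h1 h2 = s≤s (s≤s (≤-trans (s≤s z≤n) (m≤n+m (suc δ) L)))

+-≤-suc : ∀ K m m' → m' ≤ suc m → K + m' ≤ suc (K + m)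
+-≤-suc K m m' le = ≤-trans (+-monoʳ-≤ K le) (≤-reflexive (+-suc K m))

-- The trees of a unicyclic graph

module UnicyclicGraph {n g1 : ℕ} (G : Graph n) (u : Fin (suc g1) → Fin n)
   (symG : ∀ x y → G x y ≡ G y x)
   (uinj : Injective _≡_ _≡_ u)
   (cycE : ∀ i j → cycSucc (suc g1) i j ≡ true → G (u i) (u j) ≡ true)
   (uniq : ∀ k c → IsCycle G k c → ∀ x y → cycAdj k c x y ≡ cycAdj (suc g1) u x y) where

  open Cycle u uinj public

  G∖C : Graph n
  G∖C = delCycle G g u

  S : Fin g → Fin n → Bool
  S = inT G g u

  T : Fin g → Graph n
  T = treeAdj G g u

  C⊆G : ∀ x y → C x y ≡ true → G x y ≡ true
  C⊆G x y p with C-edge⇒ x y p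
  ... | a , b , refl , refl , inj₁ q = cycE a b q
  ... | a , b , refl , refl , inj₂ q = trans (symG (u a) (u b)) (cycE b a q)

  G∖C⊆G : ∀ x y → G∖C x y ≡ true → G x y ≡ true
  G∖C⊆G x y p = proj₁ (∧-true⇒ _ _ p)

  G∖C-notC : ∀ x y → G∖C x y ≡ true → C x y ≡ false
  G∖C-notC x y p with C x y | proj₂ (∧-true⇒ (G x y) _ p)
  ... | false | _ = refl

  G∖C-sym : ∀ x y → G∖C x y ≡ G∖C y x
  G∖C-sym x y = cong₂ _∧_ (symG x y) (cong not (C-sym x y))

  G-split : ∀ x y → G x y ≡ true → G∖C x y ≡ true ⊎ C x y ≡ true
  G-split x y p with C x y
  ... | true = inj₂ refl
  ... | false = inj₁ (trans (cong (_∧ true) p) refl)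

  module R∖ = Reachability G∖C
  module RS∖ = SymmetricReachability G∖C G∖C-sym
  module RG = Reachability G
  module RSG = SymmetricReachability G symG

  S-reach : ∀ m i w → reach G∖C m (u i) w ≡ true → S i w ≡ true
  S-reach m i w p = R∖.reach-mono (u i) w (m∸n≤m n 1) (R∖.reach-≤n∸1 m (u i) w p)

  S-closed : ∀ i y z → S i y ≡ true → G∖C y z ≡ true → S i z ≡ true
  S-closed i y z p e = S-reach (suc n) i z (R∖.reach-step n (u i) y z p e)

  S-self : ∀ i → S i (u i) ≡ true
  S-self i = S-reach 0 i (u i) (R∖.reach-refl (u i))

  T-sym : ∀ i x y → T i x y ≡ T i y x
  T-sym i x y = cong₂ _∧_ (G∖C-sym x y) (∧-comm (S i x) (S i y))

  module RT (i : Fin g) = Reachability (T i)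
  module RTS (i : Fin g) = SymmetricReachability (T i) (T-sym i)

  G∖C⇒T : ∀ i m y → reach G∖C m (u i) y ≡ true → reach (T i) m (u i) y ≡ true
  G∖C⇒T i zero y p = p
  G∖C⇒T i (suc m) y p with R∖.reach-suc⇒ m (u i) y p
  ... | inj₁ q = RT.reach-suc i m (u i) y (G∖C⇒T i m y q)
  ... | inj₂ (w , q1 , q2) = RT.reach-step i m (u i) w y (G∖C⇒T i m w q1)
         (∧-true q2 (∧-true (S-reach m i w q1) (S-reach (suc m) i y (R∖.reach-step m (u i) w y q1 q2))))

  T⊆G : ∀ i x y → T i x y ≡ true → G x y ≡ true
  T⊆G i x y p = G∖C⊆G x y (proj₁ (∧-true⇒ _ _ p))

  T-root : ∀ i x → S i x ≡ true → reach (T i) n (u i) x ≡ true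
  T-root i x p = G∖C⇒T i n x p

  -- A path p of G∖C from u_α to u_β, α < β, without repeated vertices and meeting C_g only
  -- at its ends, continued by the arc u_β, u_(β−1), …, u_(α+1), is a cycle of G.
  module CycleThroughPath (L : ℕ) (p : ℕ → Fin n) (α δ : ℕ) (lβ : suc (α + δ) ≤ g1)
            (e0 : p 0 ≡ uℕ α) (eL : p L ≡ uℕ (suc (α + δ))) (wk : Walk G∖C L p)
            (norep : ∀ s t → s < t → t ≤ L → p s ≢ p t)
            (noint : ∀ s e → 0 < s → s < L → e ≤ g1 → p s ≢ uℕ e) where
    β : ℕ
    β = suc (α + δ)

    k : ℕ
    k = L + suc δ

    closed : ℕ → Fin n
    closed t = if t <ᵇ L then p t else uℕ (β ∸ (t ∸ L))

    closed-< : ∀ t → t < L → closed t ≡ p t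
    closed-< t lt rewrite <⇒<ᵇ-true lt = refl

    closed-≥ : ∀ t → L ≤ t → closed t ≡ uℕ (β ∸ (t ∸ L))
    closed-≥ t le rewrite ≤⇒<ᵇ-false {t} {L} le = refl

    closed-≤ : ∀ t → t ≤ L → closed t ≡ p t
    closed-≤ t le with m≤n⇒m<n∨m≡n le
    ... | inj₁ lt = closed-< t lt
    ... | inj₂ refl = trans (closed-≥ t ≤-refl) (trans (cong (λ z → uℕ (β ∸ z)) (n∸n≡0 t)) (sym eL))

    cyc : Fin k → Fin n
    cyc i = closed (toℕ i)

    β≤ : ∀ j → β ∸ j ≤ g1
    β≤ j = ≤-trans (m∸n≤m β j) lβ

    closed-edge : ∀ t → suc t < k → G (closed t) (closed (suc t)) ≡ true
    closed-edge t lt with t <? L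
    ... | yes tL rewrite closed-< t tL | closed-≤ (suc t) tL = G∖C⊆G _ _ (wk t tL)
    ... | no ntL = subst₂ (λ a b → G a b ≡ true) (sym (closed-≥ t Lt)) (sym (closed-≥ (suc t) (m≤n⇒m≤1+n Lt))) e
      where
      Lt : L ≤ t
      Lt = ≮⇒≥ ntL
      j' = t ∸ L
      sj : suc t ∸ L ≡ suc j'
      sj = +-∸-assoc 1 Lt
      j'<δ : suc j' ≤ δ
      j'<δ = ≤-pred (subst (_< suc δ) sj (subst (suc t ∸ L <_) (m+n∸m≡n L (suc δ)) (∸-monoˡ-< lt (m≤n⇒m≤1+n Lt))))
      x = β ∸ suc j'
      sj≤β : suc j' ≤ β
      sj≤β = ≤-trans j'<δ (≤-trans (m≤n+m δ α) (n≤1+n _))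
      xs : β ∸ j' ≡ suc x
      xs = sym (trans (sym (+-∸-assoc 1 sj≤β)) refl)
      e : G (uℕ (β ∸ j')) (uℕ (β ∸ (suc t ∸ L))) ≡ true
      e rewrite xs | sj = C⊆G _ _ (trans (C-sym (uℕ (suc x)) (uℕ x)) (C-edgeℕ x (suc x) (≤-trans (n≤1+n x) (subst (_≤ g1) xs (β≤ j'))) (subst (_≤ g1) xs (β≤ j')) (inj₁ refl)))

    eqα : β ∸ δ ≡ suc α
    eqα = m+n∸n≡m (suc α) δ

    sα : suc α ≤ g1
    sα = ≤-trans (s≤s (m≤m+n α δ)) lβ

    closing-edge : 0 < L → G (closed (k ∸ 1)) (closed 0) ≡ true
    closing-edge 0<L rewrite closed-< 0 0<L | e0 | +-suc L δ | closed-≥ (L + δ) (m≤m+n L δ) | m+n∸m≡n L δ | eqα =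
      C⊆G _ _ (trans (C-sym (uℕ (suc α)) (uℕ α)) (C-edgeℕ α (suc α) (≤-trans (n≤1+n α) sα) sα (inj₁ refl)))

    jbound : ∀ x → L ≤ x → x < k → x ∸ L ≤ δ
    jbound x le xk = ≤-pred (subst (x ∸ L <_) (m+n∸m≡n L (suc δ)) (∸-monoˡ-< xk le))

    δ≤β : δ ≤ β
    δ≤β = ≤-trans (m≤n+m δ α) (n≤1+n _)

    cyc-edges : 0 < L → ∀ i j → cycSucc k i j ≡ true → G (cyc i) (cyc j) ≡ true
    cyc-edges 0<L i j p with cycSucc⇒ k i j p
    ... | inj₁ q rewrite sym q = closed-edge (toℕ i) (subst (_< k) (sym q) (Finₚ.toℕ<n j))
    ... | inj₂ (q1 , q2) rewrite q1 | q2 = closing-edge 0<L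

    closed-injective : ∀ s t → s < t → t < k → closed s ≡ closed t → ⊥
    closed-injective s t st tk eq with t ≤? L
    ... | yes tL rewrite closed-≤ s (≤-trans (<⇒≤ st) tL) | closed-≤ t tL = norep s t st tL eq
    ... | no ntL with s <? L
    ... | yes sL rewrite closed-< s sL | closed-≥ t (<⇒≤ (≰⇒> ntL)) = h s refl eq
      where
      jt = t ∸ L
      jt≤δ : jt ≤ δ
      jt≤δ = jbound t (<⇒≤ (≰⇒> ntL)) tk
      h : ∀ s' → s' ≡ s → p s' ≡ uℕ (β ∸ jt) → ⊥
      h zero refl q = <⇒≱ lt (≤-reflexive (sym (uℕ-injective α (β ∸ jt) (≤-trans (n≤1+n α) (≤-trans (s≤s (m≤m+n α δ)) lβ)) (β≤ jt) (trans (sym e0) q))))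
        where
        lt : α < β ∸ jt
        lt = ≤-trans (≤-reflexive (sym eqα)) (∸-monoʳ-≤ β jt≤δ)
      h (suc s') refl q = noint (suc s') (β ∸ jt) (s≤s z≤n) sL (β≤ jt) q
    ... | no nsL rewrite closed-≥ s (≮⇒≥ nsL) | closed-≥ t (<⇒≤ (≰⇒> ntL)) =
          <⇒≢ (∸-monoˡ-< st (≮⇒≥ nsL)) (∸-cancelˡ-≡ (j≤β s (≮⇒≥ nsL) (<-trans st tk)) (j≤β t (<⇒≤ (≰⇒> ntL)) tk) (uℕ-injective _ _ (β≤ (s ∸ L)) (β≤ (t ∸ L)) eq))
      where
      j≤β : ∀ x → L ≤ x → x < k → x ∸ L ≤ β
      j≤β x le xk = ≤-trans (jbound x le xk) δ≤β

    cyc-injective : Injective _≡_ _≡_ cyc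
    cyc-injective {i} {j} eq with <-cmp (toℕ i) (toℕ j)
    ... | tri< lt _ _ = ⊥-elim (closed-injective _ _ lt (Finₚ.toℕ<n j) eq)
    ... | tri≈ _ e _ = Finₚ.toℕ-injective e
    ... | tri> _ _ gt = ⊥-elim (closed-injective _ _ gt (Finₚ.toℕ<n i) (sym eq))

    lβ' : α ≤ g1
    lβ' = ≤-trans (≤-trans (m≤m+n α δ) (n≤1+n _)) lβ

    impossible : ⊥
    impossible with L ≟ℕ 0
    ... | yes L0 = <⇒≢ (s≤s (m≤m+n α δ)) (uℕ-injective α β lβ' lβ (trans (sym e0) (trans (cong p (sym L0)) eL)))
    ... | no L≠0 = uniqueness-violated
      where
      0<L : 0 < L
      0<L = n≢0⇒n>0 L≠0
      not-single-edge : L ≡ 1 → δ ≡ 0 → ⊥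
      not-single-edge L1 δ0 = true≢false (trans (sym C-edge-p0p1) (G∖C-notC _ _ (wk 0 0<L)))
        where
        C-edge-p0p1 : C (p 0) (p 1) ≡ true
        C-edge-p0p1 = subst₂ (λ a b → C a b ≡ true) (sym e0) (sym (trans (cong p (sym L1)) eL))
               (C-edgeℕ α β lβ' lβ (inj₁ (cong suc (trans (sym (+-identityʳ α)) (cong (α +_) (sym δ0))))))
      3≤k : 3 ≤ k
      3≤k = 3≤cycle-length L δ L≠0 not-single-edge
      second-cycle : IsCycle G k cyc
      second-cycle = 3≤k , cyc-injective , cyc-edges 0<L
      -- p 0 p 1 is an edge of the second cycle, but it lies in G∖C, so not on C_g.
      uniqueness-violated : ⊥
      uniqueness-violated = true≢false (trans (sym (cycAdj-first-edge k cyc 3≤k (p 0) (p 1) h0 h1)) (trans (uniq k cyc second-cycle (p 0) (p 1)) (G∖C-notC _ _ (wk 0 0<L))))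
        where
        h0 : ∀ i → toℕ i ≡ 0 → cyc i ≡ p 0
        h0 i e rewrite e = closed-< 0 0<L
        h1 : ∀ i → toℕ i ≡ 1 → cyc i ≡ p 1
        h1 i e rewrite e = closed-≤ 1 0<L

  NoPathBetween : ℕ → Set
  NoPathBetween L = ∀ (p : ℕ → Fin n) α β → α ≤ g1 → β ≤ g1 → α ≢ β → p 0 ≡ uℕ α → p L ≡ uℕ β → Walk G∖C L p → ⊥

  touches-cycle? : ∀ (p : ℕ → Fin n) L → Dec (Σ ℕ λ s → Σ ℕ λ e → 0 < s × s < L × e ≤ g1 × p s ≡ uℕ e)
  touches-cycle? p L with Finₚ.any? {n = L} (λ s → Finₚ.any? {n = g} (λ e → (0 <? toℕ s) ×-dec (p (toℕ s) ≟ uℕ (toℕ e))))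
  ... | yes (s , e , lt , eq) = yes (toℕ s , toℕ e , lt , Finₚ.toℕ<n s , toℕ≤ g1 e , eq)
  ... | no nn = no h
    where
    h : ¬ (Σ ℕ λ s → Σ ℕ λ e → 0 < s × s < L × e ≤ g1 × p s ≡ uℕ e)
    h (s , e , 0<s , sL , eg , eq) = nn (fromℕ< sL , fromℕ< {e} {g} (s≤s eg) , lt' , eq')
      where
      lt' : 0 < toℕ (fromℕ< sL)
      lt' rewrite Finₚ.toℕ-fromℕ< sL = 0<s
      eq' : p (toℕ (fromℕ< sL)) ≡ uℕ (toℕ (fromℕ< {e} {g} (s≤s eg)))
      eq' rewrite Finₚ.toℕ-fromℕ< sL | Finₚ.toℕ-fromℕ< {e} {g} (s≤s eg) = eq

  -- Induction on the length, bounded by the fuel F: a repeated vertex, or a cycle vertex in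
  -- the interior, gives a shorter walk between distinct cycle vertices; otherwise the walk
  -- closes up to a second cycle.
  no-path-between : ∀ F L → L ≤ F → NoPathBetween L
  no-increasing-path : ∀ F L → L ≤ F → ∀ p α β → α < β → β ≤ g1 → p 0 ≡ uℕ α → p L ≡ uℕ β → Walk G∖C L p → ⊥
  no-shorter-path : ∀ F L → L ≤ F → ∀ L' → L' < L → NoPathBetween L'

  no-path-between F L le p α β lα lβ ne e0 eL wk with <-cmp α β
  ... | tri≈ _ e _ = ne e
  ... | tri< lt _ _ = no-increasing-path F L le p α β lt lβ e0 eL wk
  ... | tri> _ _ gt = no-increasing-path F L le (λ m → p (L ∸ m)) β α gt lα eL (trans (cong p (n∸n≡0 L)) e0) (RS∖.reverse-walk L p wk)

  no-increasing-path F L le p α β lt lβ e0 eL wk with repeats? p L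
  ... | yes (s , t , st , tL , eq) with R∖.shortcut-walk p s t L st tL eq wk
  ... | q , L' , L'<L , wq , q0 , qL = no-shorter-path F L le L' L'<L q α β (≤-trans (<⇒≤ lt) lβ) lβ (<⇒≢ lt) (trans q0 e0) (trans qL eL) wq
  no-increasing-path F L le p α β lt lβ e0 eL wk | no norep with touches-cycle? p L
  ... | yes (s , e , 0<s , sL , le' , eq) with e ≟ℕ α
  ...   | no e≢α = no-shorter-path F L le s sL p α e (≤-trans (<⇒≤ lt) lβ) le' (λ z → e≢α (sym z)) e0 eq (λ m ml → wk m (<-trans ml sL))
  ...   | yes refl = no-shorter-path F L le (L ∸ s) (∸-monoʳ-< 0<s (<⇒≤ sL)) (λ m → p (s + m)) e β le' lβ (<⇒≢ lt)
             (trans (cong p (+-identityʳ s)) eq) (trans (cong p (m+[n∸m]≡n (<⇒≤ sL))) eL) (R∖.suffix-walk L p s (L ∸ s) (m+[n∸m]≡n (<⇒≤ sL)) wk)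
  no-increasing-path F L le p α β lt lβ e0 eL wk | no norep | no noint with m≤n⇒∃[o]m+o≡n lt
  ... | δ , refl = CycleThroughPath.impossible L p α δ lβ e0 eL wk (λ s t a b e → norep (s , t , a , b , e)) (λ s e a b c d → noint (s , e , a , b , c , d))

  no-shorter-path zero L le L' lt = ⊥-elim (<⇒≱ (≤-trans lt le) z≤n)
  no-shorter-path (suc F) L le L' lt = no-path-between F L' (≤-pred (≤-trans lt le))

  trees-disjoint : ∀ i j w → S i w ≡ true → S j w ≡ true → i ≡ j
  trees-disjoint i j w si sj with i ≟ j
  ... | yes e = e
  ... | no ne with R∖.reach→walk (n + n) (u i) (u j) (R∖.reach-trans n n (u i) w (u j) si (RS∖.reach-sym n (u j) w sj))
  ... | L , p , _ , p0 , pL , wk = ⊥-elim (no-path-between L L ≤-refl p (toℕ i) (toℕ j) (toℕ≤ g1 i) (toℕ≤ g1 j)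
          (λ e → ne (Finₚ.toℕ-injective e)) (trans p0 (sym (uℕ-toℕ i))) (trans pL (sym (uℕ-toℕ j))) wk)

  -- Distances and the Wiener index

  module Connected (conn : IsConnected G) where

    module RC = Reachability C
    module RCS = SymmetricReachability C C-sym

    reach⇒in-some-tree : ∀ m w → reach G m (u zero) w ≡ true → Σ (Fin g) λ i → S i w ≡ true
    reach⇒in-some-tree zero w p with RG.reach0⇒≡ {u zero} {w} p
    ... | refl = zero , S-self zero
    reach⇒in-some-tree (suc m) w p with RG.reach-suc⇒ m (u zero) w p
    ... | inj₁ q = reach⇒in-some-tree m w q
    ... | inj₂ (v , q1 , q2) with reach⇒in-some-tree m v q1 | G-split v w q2
    ... | i , si | inj₁ d = i , S-closed i v w si d
    ... | i , si | inj₂ c with C-edge⇒ v w c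
    ... | a , b , _ , refl , _ = b , S-self b

    in-some-tree : ∀ w → Σ (Fin g) λ i → S i w ≡ true
    in-some-tree w = reach⇒in-some-tree (proj₁ (conn (u zero) w)) w (proj₂ (conn (u zero) w))

    treeOf : Fin n → Fin g
    treeOf w = proj₁ (in-some-tree w)

    treeOf-S : ∀ w → S (treeOf w) w ≡ true
    treeOf-S w = proj₂ (in-some-tree w)

    treeOf-unique : ∀ a w → S a w ≡ true → treeOf w ≡ a
    treeOf-unique a w s = trees-disjoint (treeOf w) a w (treeOf-S w) s

    dC : Fin g → Fin g → ℕ
    dC a b = dist C (u a) (u b)

    C-reach : ∀ a b → reach C (dC a b) (u a) (u b) ≡ true
    C-reach a b = RC.reach-dist (arcDist (toℕ a) (toℕ b)) (u a) (u b) (subst₂ (λ x y → reach C (arcDist (toℕ a) (toℕ b)) x y ≡ true) (uℕ-toℕ a) (uℕ-toℕ b)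
                    (reach-arcDist (toℕ a) (toℕ b) (toℕ≤ g1 a) (toℕ≤ g1 b)))

    dT : Fin g → Fin n → Fin n → ℕ
    dT a x y = dist (T a) x y

    T-reach : ∀ a x y → S a x ≡ true → S a y ≡ true → reach (T a) (n + n) x y ≡ true
    T-reach a x y sx sy = RT.reach-trans a n n x (u a) y (RTS.reach-sym a n (u a) x (T-root a x sx)) (T-root a y sy)

    T-edge : ∀ a w y → S a w ≡ true → G∖C w y ≡ true → T a w y ≡ true
    T-edge a w y s d = ∧-true d (∧-true s (S-closed a w y s d))

    dT-tri : ∀ a x w y → S a x ≡ true → S a w ≡ true → S a y ≡ true → dT a x y ≤ dT a x w + dT a w y
    dT-tri a x w y sx sw sy = RT.dist-tri a (n + n) (n + n) x w y (T-reach a x w sx sw) (T-reach a w y sw sy)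

    dT-sym : ∀ a x y → S a x ≡ true → S a y ≡ true → dT a x y ≡ dT a y x
    dT-sym a x y sx sy = RTS.dist-sym a (n + n) x y (T-reach a x y sx sy)

    dC-tri : ∀ a b c → dC a c ≤ dC a b + dC b c
    dC-tri a b c = RC.dist-tri (dC a b) (dC b c) (u a) (u b) (u c) (C-reach a b) (C-reach b c)

    dC-sym : ∀ a b → dC a b ≡ dC b a
    dC-sym a b = RCS.dist-sym (dC a b) (u a) (u b) (C-reach a b)

    dC-self : ∀ a → dC a a ≡ 0
    dC-self a = RC.dist-self (u a)

    dT-self : ∀ a x → dT a x x ≡ 0
    dT-self a x = RT.dist-self a x

    -- The claimed distance from x: the tree distance inside x's tree; otherwise x to its root,
    -- then along C_g, then the root of the target's tree to the target. It grows by at most 1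
    -- along every edge and is realised by a walk, so it is the distance.
    module _ (x : Fin n) where
      a : Fin g
      a = treeOf x

      pot : Fin n → ℕ
      pot y = if does (treeOf y ≟ a) then dT a x y else dT a (u a) x + dC a (treeOf y) + dT (treeOf y) (u (treeOf y)) y

      pot-same : ∀ y → treeOf y ≡ a → pot y ≡ dT a x y
      pot-same y e rewrite e | does-≟-refl a = refl

      pot-diff : ∀ y → treeOf y ≢ a → pot y ≡ dT a (u a) x + dC a (treeOf y) + dT (treeOf y) (u (treeOf y)) y
      pot-diff y ne rewrite does-≟-≢ (treeOf y) a ne = refl

      pot-source : pot x ≡ 0
      pot-source = trans (pot-same x refl) (dT-self a x)

      sx : S a x ≡ true
      sx = treeOf-S x

      pot-root : ∀ c → pot (u c) ≡ (if does (c ≟ a) then dT a x (u a) else dT a (u a) x + dC a c)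
      pot-root c with c ≟ a
      ... | yes refl = pot-same (u c) (treeOf-unique c (u c) (S-self c))
      ... | no ne = trans (pot-diff (u c) (λ e → ne (trans (sym (treeOf-unique c (u c) (S-self c))) e)))
                   (trans (cong (λ z → dT a (u a) x + dC a z + dT z (u z) (u c)) (treeOf-unique c (u c) (S-self c)))
                          (trans (cong (dT a (u a) x + dC a c +_) (dT-self c (u c))) (+-identityʳ _)))

      pot-edge-G∖C : ∀ w y → G∖C w y ≡ true → pot y ≤ suc (pot w)
      pot-edge-G∖C w y d = h (treeOf w ≟ a)
       where
       h : Dec (treeOf w ≡ a) → pot y ≤ suc (pot w)
       h (yes e) rewrite pot-same y (trans (treeOf-unique (treeOf w) y (S-closed (treeOf w) w y (treeOf-S w) d)) e) | pot-same w e =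
            ≤-trans (dT-tri a x w y sx sw sy) (≤-trans (+-monoʳ-≤ (dT a x w) (RT.dist-edge≤1 a w y (T-edge a w y sw d))) (≤-reflexive (+-comm (dT a x w) 1)))
        where
        sw : S a w ≡ true
        sw = subst (λ z → S z w ≡ true) e (treeOf-S w)
        sy : S a y ≡ true
        sy = S-closed a w y sw d
       h (no ne) = subst₂ _≤_ (sym (trans (pot-diff y ne') (cong (λ z → dT a (u a) x + dC a z + dT z (u z) y) treeOf-y)))
                           (cong suc (sym (pot-diff w ne))) (+-≤-suc (dT a (u a) x + dC a b) _ _ e1)
        where
        b = treeOf w
        sw = treeOf-S w
        sy : S b y ≡ true
        sy = S-closed b w y sw d
        treeOf-y : treeOf y ≡ b
        treeOf-y = treeOf-unique b y sy
        ne' : treeOf y ≢ a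
        ne' e = ne (trans (sym treeOf-y) e)
        e1 : dT b (u b) y ≤ suc (dT b (u b) w)
        e1 = ≤-trans (dT-tri b (u b) w y (S-self b) sw sy) (≤-trans (+-monoʳ-≤ (dT b (u b) w) (RT.dist-edge≤1 b w y (T-edge b w y sw d))) (≤-reflexive (+-comm (dT b (u b) w) 1)))

      dT-x-root-sym : dT a x (u a) ≡ dT a (u a) x
      dT-x-root-sym = dT-sym a x (u a) sx (S-self a)

      pot-edge-C : ∀ w y → C w y ≡ true → pot y ≤ suc (pot w)
      pot-edge-C w y cw with C-edge⇒ w y cw
      ... | c , e , refl , refl , _ rewrite pot-root c | pot-root e = h (c ≟ a) (e ≟ a)
        where
        ce : dC c e ≤ 1
        ce = RC.dist-edge≤1 (u c) (u e) cw
        K1 = dT a x (u a)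
        K2 = dT a (u a) x
        h : (dc : Dec (c ≡ a)) → (de : Dec (e ≡ a)) →
            (if does de then K1 else K2 + dC a e) ≤ suc (if does dc then K1 else K2 + dC a c)
        h (yes _) (yes _) = n≤1+n K1
        h (yes refl) (no _) = ≤-trans (+-monoʳ-≤ K2 ce) (≤-reflexive (trans (+-comm K2 1) (cong suc (sym dT-x-root-sym))))
        h (no _) (yes _) = ≤-trans (≤-reflexive dT-x-root-sym) (≤-trans (m≤m+n K2 (dC a c)) (n≤1+n _))
        h (no _) (no _) = +-≤-suc K2 (dC a c) (dC a e) (≤-trans (dC-tri a c e) (≤-trans (+-monoʳ-≤ (dC a c) ce) (≤-reflexive (+-comm (dC a c) 1))))

      pot-edge : ∀ w y → G w y ≡ true → pot y ≤ suc (pot w)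
      pot-edge w y gw with G-split w y gw
      ... | inj₁ d = pot-edge-G∖C w y d
      ... | inj₂ c = pot-edge-C w y c

      reach-pot : ∀ y → reach G (pot y) x y ≡ true
      reach-pot y = h (treeOf y ≟ a)
        where
        h : Dec (treeOf y ≡ a) → reach G (pot y) x y ≡ true
        h (yes e) rewrite pot-same y e = RT.reach-⊆ a G (T⊆G a) (dT a x y) x y (RT.reach-dist a (n + n) x y (T-reach a x y sx sy))
          where
          sy : S a y ≡ true
          sy = subst (λ z → S z y ≡ true) e (treeOf-S y)
        h (no ne) rewrite pot-diff y ne = RG.reach-trans (dT a (u a) x + dC a b) (dT b (u b) y) x (u b) y
             (RG.reach-trans (dT a (u a) x) (dC a b) x (u a) (u b)
                (RT.reach-⊆ a G (T⊆G a) (dT a (u a) x) x (u a) (RTS.reach-sym a (dT a (u a) x) (u a) x (RT.reach-dist a n (u a) x (T-root a x sx))))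
                (RC.reach-⊆ G C⊆G (dC a b) (u a) (u b) (C-reach a b)))
             (RT.reach-⊆ b G (T⊆G b) (dT b (u b) y) (u b) y (RT.reach-dist b n (u b) y (T-root b y (treeOf-S y))))
          where
          b = treeOf y

      dist≡pot : ∀ y → dist G x y ≡ pot y
      dist≡pot y = RG.dist≡potential x y pot pot-source pot-edge (reach-pot y)

    dist-same-tree : ∀ a x y → S a x ≡ true → S a y ≡ true → dist G x y ≡ dT a x y
    dist-same-tree a x y sx sy with treeOf-unique a x sx
    ... | refl = trans (dist≡pot x y) (pot-same x y (treeOf-unique (treeOf x) y sy))

    dist-different-trees : ∀ a b x y → S a x ≡ true → S b y ≡ true → a ≢ b → dist G x y ≡ dT a (u a) x + dC a b + dT b (u b) y
    dist-different-trees a b x y sx sy ne with treeOf-unique a x sx | treeOf-unique b y sy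
    ... | refl | refl = trans (dist≡pot x y) (pot-diff x y (λ e → ne (sym e)))

    dG : Fin n → Fin n → ℕ
    dG = dist G

    ni : Fin g → ℕ
    ni a = count n (S a)

    dTs : Fin g → ℕ
    dTs a = dsub (T a) (S a) (u a)

    WT : Fin g → ℕ
    WT a = Wsub (T a) (S a)

    pairTerm : Fin g → Fin g → ℕ
    pairTerm i j = (ni i ∸ 1) * dTs j + (ni j ∸ 1) * dTs i + (ni i ∸ 1) * (ni j ∸ 1) * dC i j

    ⌊g²/4⌋ : ℕ
    ⌊g²/4⌋ = (g * g) / 4

    2W≡∑∑dist : 2 * W G ≡ ∑ n (λ x → ∑ n (λ y → dG x y))
    2W≡∑∑dist = sym (trans (∑∑≡2*pairSum+diagonal n dG (λ x y → RSG.dist-sym (proj₁ (conn x y)) x y (proj₂ (conn x y))))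
                       (trans (cong (2 * W G +_) (∑≡0 n _ (λ x → RG.dist-self x))) (+-identityʳ _)))

    S≡treeOf : ∀ a x → S a x ≡ does (treeOf x ≟ a)
    S≡treeOf a x with treeOf x ≟ a
    ... | yes refl = treeOf-S x
    ... | no ne with S a x in e
    ... | true = ⊥-elim (ne (treeOf-unique a x e))
    ... | false = refl

    ∑-partition : ∀ (h : Fin n → ℕ) → ∑ n h ≡ ∑ g (λ a → ∑ n (λ x → ind (S a x) (h x)))
    ∑-partition h = trans (∑-cong n _ _ (λ x → sym (trans (∑-cong g _ _ (λ a → cong (λ b → ind b (h x)) (S≡treeOf a x))) (∑-delta g (treeOf x) (λ _ → h x)))))
                   (∑-swap n g (λ x a → ind (S a x) (h x)))

    block : Fin g → Fin g → ℕ
    block a b = ∑ n (λ x → ∑ n (λ y → ind (S a x) (ind (S b y) (dG x y))))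

    ∑∑dist≡∑∑block : ∑ n (λ x → ∑ n (λ y → dG x y)) ≡ ∑ g (λ a → ∑ g (λ b → block a b))
    ∑∑dist≡∑∑block = begin
        ∑ n (λ x → ∑ n (λ y → dG x y))
      ≡⟨ ∑-partition (λ x → ∑ n (λ y → dG x y)) ⟩
        ∑ g (λ a → ∑ n (λ x → ind (S a x) (∑ n (λ y → dG x y))))
      ≡⟨ ∑-cong g _ _ (λ a → ∑-cong n _ _ (λ x → cong (ind (S a x)) (∑-partition (λ y → dG x y)))) ⟩
        ∑ g (λ a → ∑ n (λ x → ind (S a x) (∑ g (λ b → ∑ n (λ y → ind (S b y) (dG x y))))))
      ≡⟨ ∑-cong g _ _ (λ a → ∑-cong n _ _ (λ x → trans (ind-∑ (S a x) g (λ b → ∑ n (λ y → ind (S b y) (dG x y)))) (∑-cong g _ _ (λ b → ind-∑ (S a x) n (λ y → ind (S b y) (dG x y)))))) ⟩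
        ∑ g (λ a → ∑ n (λ x → ∑ g (λ b → ∑ n (λ y → ind (S a x) (ind (S b y) (dG x y))))))
      ≡⟨ ∑-cong g _ _ (λ a → ∑-swap n g (λ x b → ∑ n (λ y → ind (S a x) (ind (S b y) (dG x y))))) ⟩
        ∑ g (λ a → ∑ g (λ b → block a b)) ∎

    treeDist : Fin g → Fin n → Fin n → ℕ
    treeDist a x y = if S a x ∧ S a y then dist (T a) x y else 0

    block-diagonal : ∀ a → block a a ≡ 2 * WT a
    block-diagonal a = begin
        block a a
      ≡⟨ ∑-cong n _ _ (λ x → ∑-cong n _ _ (λ y → restrict x y)) ⟩
        ∑ n (λ x → ∑ n (λ y → treeDist a x y))
      ≡⟨ ∑∑≡2*pairSum+diagonal n (treeDist a) treeDist-sym ⟩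
        2 * WT a + ∑ n (λ x → treeDist a x x)
      ≡⟨ cong (2 * WT a +_) (∑≡0 n _ (λ x → treeDist-diagonal x)) ⟩
        2 * WT a + 0
      ≡⟨ +-identityʳ _ ⟩
        2 * WT a ∎
      where
      restrict : ∀ x y → ind (S a x) (ind (S a y) (dG x y)) ≡ treeDist a x y
      restrict x y with S a x in ∑-depth | S a y in e2
      ... | true | true = dist-same-tree a x y ∑-depth e2
      ... | true | false = refl
      ... | false | _ = refl
      treeDist-sym : ∀ x y → treeDist a x y ≡ treeDist a y x
      treeDist-sym x y with S a x in ∑-depth | S a y in e2
      ... | true | true = dT-sym a x y ∑-depth e2
      ... | true | false = refl
      ... | false | true = refl
      ... | false | false = refl
      treeDist-diagonal : ∀ x → treeDist a x x ≡ 0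
      treeDist-diagonal x with S a x
      ... | true = dT-self a x
      ... | false = refl

    depth : Fin g → Fin n → ℕ
    depth a x = dT a (u a) x

    crossBlock : Fin g → Fin g → ℕ
    crossBlock a b = ni b * dTs a + ni a * (ni b * dC a b) + ni a * dTs b

    block-off-diagonal : ∀ a b → a ≢ b → block a b ≡ crossBlock a b
    block-off-diagonal a b ne = begin
        block a b
      ≡⟨ ∑-cong n _ _ (λ x → ∑-cong n _ _ (λ y → restrict x y)) ⟩
        ∑ n (λ x → ∑ n (λ y → ind (S a x) (ind (S b y) (depth a x + dC a b + depth b y))))
      ≡⟨ ∑-cong n _ _ (λ x → sym (ind-∑ (S a x) n _)) ⟩
        ∑ n (λ x → ind (S a x) (∑ n (λ y → ind (S b y) (depth a x + dC a b + depth b y))))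
      ≡⟨ ∑-cong n _ _ (λ x → cong (ind (S a x)) (∑-cross-row x)) ⟩
        ∑ n (λ x → ind (S a x) (ni b * depth a x + ni b * dC a b + dTs b))
      ≡⟨ ∑-cong n _ _ (λ x → trans (ind-+ (S a x) _ _) (cong (_+ ind (S a x) (dTs b)) (ind-+ (S a x) _ _))) ⟩
        ∑ n (λ x → ind (S a x) (ni b * depth a x) + ind (S a x) (ni b * dC a b) + ind (S a x) (dTs b))
      ≡⟨ trans (∑-+ n _ _) (cong (_+ ∑ n (λ x → ind (S a x) (dTs b))) (∑-+ n _ _)) ⟩
        ∑ n (λ x → ind (S a x) (ni b * depth a x)) + ∑ n (λ x → ind (S a x) (ni b * dC a b)) + ∑ n (λ x → ind (S a x) (dTs b))
      ≡⟨ cong₂ _+_ (cong₂ _+_ ∑-depth (∑-ind≡count* n (S a) _)) (∑-ind≡count* n (S a) _) ⟩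
        ni b * dTs a + ni a * (ni b * dC a b) + ni a * dTs b ∎
      where
      restrict : ∀ x y → ind (S a x) (ind (S b y) (dG x y)) ≡ ind (S a x) (ind (S b y) (depth a x + dC a b + depth b y))
      restrict x y with S a x in ∑-depth | S b y in e2
      ... | true | true = dist-different-trees a b x y ∑-depth e2 ne
      ... | true | false = refl
      ... | false | _ = refl
      ∑-cross-row : ∀ x → ∑ n (λ y → ind (S b y) (depth a x + dC a b + depth b y)) ≡ ni b * depth a x + ni b * dC a b + dTs b
      ∑-cross-row x = begin
          ∑ n (λ y → ind (S b y) (depth a x + dC a b + depth b y))
        ≡⟨ ∑-cong n _ _ (λ y → ind-+ (S b y) _ _) ⟩
          ∑ n (λ y → ind (S b y) (depth a x + dC a b) + ind (S b y) (depth b y))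
        ≡⟨ ∑-+ n _ _ ⟩
          ∑ n (λ y → ind (S b y) (depth a x + dC a b)) + dTs b
        ≡⟨ cong (_+ dTs b) (trans (∑-ind≡count* n (S b) _) (trans (*-comm (ni b) _) (trans (*-distribʳ-+ (ni b) (depth a x) (dC a b)) (cong₂ _+_ (*-comm (depth a x) _) (*-comm (dC a b) _))))) ⟩
          ni b * depth a x + ni b * dC a b + dTs b ∎
      ∑-depth : ∑ n (λ x → ind (S a x) (ni b * depth a x)) ≡ ni b * dTs a
      ∑-depth = trans (∑-cong n _ _ (λ x → sym (ind-*ˡ (S a x) (ni b) (depth a x)))) (∑-*ˡ n (ni b) _)

    NE : Fin g → Fin g → Bool
    NE a b = not (does (a ≟ b))

    ∑∑block-split : ∑ g (λ a → ∑ g (λ b → block a b)) ≡ 2 * ∑ g WT + ∑ g (λ a → ∑ g (λ b → ind (NE a b) (crossBlock a b)))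
    ∑∑block-split = begin
        ∑ g (λ a → ∑ g (λ b → block a b))
      ≡⟨ ∑-cong g _ _ (λ a → ∑-cong g _ _ (λ b → restrict a b)) ⟩
        ∑ g (λ a → ∑ g (λ b → ind (does (a ≟ b)) (2 * WT a) + ind (NE a b) (crossBlock a b)))
      ≡⟨ ∑∑-+ g g (λ a b → ind (does (a ≟ b)) (2 * WT a)) (λ a b → ind (NE a b) (crossBlock a b)) ⟩
        ∑ g (λ a → ∑ g (λ b → ind (does (a ≟ b)) (2 * WT a))) + ∑ g (λ a → ∑ g (λ b → ind (NE a b) (crossBlock a b)))
      ≡⟨ cong (_+ ∑ g (λ a → ∑ g (λ b → ind (NE a b) (crossBlock a b)))) (trans (∑-cong g _ _ (λ a → ∑-delta g a (λ _ → 2 * WT a))) (∑-*ˡ g 2 WT)) ⟩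
        2 * ∑ g WT + ∑ g (λ a → ∑ g (λ b → ind (NE a b) (crossBlock a b))) ∎
      where
      restrict : ∀ a b → block a b ≡ ind (does (a ≟ b)) (2 * WT a) + ind (NE a b) (crossBlock a b)
      restrict a b with a ≟ b
      ... | yes refl = trans (block-diagonal a) (sym (+-identityʳ _))
      ... | no ne = block-off-diagonal a b ne

    m : Fin g → ℕ
    m a = ni a ∸ 1

    ni≡suc-m : ∀ a → ni a ≡ suc (m a)
    ni≡suc-m a = sym (trans (+-comm 1 (m a)) (m∸n+n≡m ni≥1))
      where
      ni≥1 : 1 ≤ ni a
      ni≥1 = subst (λ z → suc z ≤ ni a) (∑≡0 n _ (λ _ → refl)) (count-< n (λ _ → false) (S a) (λ _ ()) (u a) (S-self a) refl)

    -- With n_i = 1 + m_i, the cross block splits into the pair term of the statement, the two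
    -- root-distance sums, and the cycle contribution.
    cross-expand : ∀ A B X Y c → suc B * X + suc A * (suc B * c) + suc A * Y ≡ (A * Y + B * X + A * B * c) + (X + Y) + (c + (A * c + B * c))
    cross-expand = solve 5 (λ A B X Y c → (con 1 :+ B) :* X :+ (con 1 :+ A) :* ((con 1 :+ B) :* c) :+ (con 1 :+ A) :* Y
                            := (A :* Y :+ B :* X :+ A :* B :* c) :+ (X :+ Y) :+ (c :+ (A :* c :+ B :* c))) refl

    cycleTerm : Fin g → Fin g → ℕ
    cycleTerm a b = dC a b + (m a * dC a b + m b * dC a b)

    crossBlock-decompose : ∀ a b → crossBlock a b ≡ pairTerm a b + (dTs a + dTs b) + cycleTerm a b
    crossBlock-decompose a b = trans (cong₂ (λ p q → q * dTs a + p * (q * dC a b) + p * dTs b) (ni≡suc-m a) (ni≡suc-m b)) (cross-expand (m a) (m b) (dTs a) (dTs b) (dC a b))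

    pairTerm-sym : ∀ a b → pairTerm a b ≡ pairTerm b a
    pairTerm-sym a b = trans (cong (λ z → m a * dTs b + m b * dTs a + m a * m b * z) (dC-sym a b)) (swap-roles (m a) (m b) (dTs a) (dTs b) (dC b a))
      where
      swap-roles : ∀ A B X Y c → A * Y + B * X + A * B * c ≡ B * X + A * Y + B * A * c
      swap-roles = solve 5 (λ A B X Y c → A :* Y :+ B :* X :+ A :* B :* c := B :* X :+ A :* Y :+ B :* A :* c) refl

    M : ℕ
    M = ∑ g m

    n≡g+M : n ≡ g + M
    n≡g+M = begin
        n
      ≡⟨ sym (*-identityʳ n) ⟩
        n * 1
      ≡⟨ sym (∑-const n 1) ⟩
        ∑ n (λ _ → 1)
      ≡⟨ ∑-partition (λ _ → 1) ⟩
        ∑ g ni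
      ≡⟨ ∑-cong g _ _ ni≡suc-m ⟩
        ∑ g (λ a → 1 + m a)
      ≡⟨ ∑-+ g (λ _ → 1) m ⟩
        ∑ g (λ _ → 1) + M
      ≡⟨ cong (_+ M) (trans (∑-const g 1) (*-identityʳ g)) ⟩
        g + M ∎

    D : ℕ
    D = ∑ g dTs

    ∑∑-depth-part : ∑ g (λ a → ∑ g (λ b → ind (NE a b) (dTs a + dTs b))) ≡ g1 * D + g1 * D
    ∑∑-depth-part = begin
        ∑ g (λ a → ∑ g (λ b → ind (NE a b) (dTs a + dTs b)))
      ≡⟨ ∑-cong g _ _ (λ a → ∑-cong g _ _ (λ b → ind-+ (NE a b) (dTs a) (dTs b))) ⟩
        ∑ g (λ a → ∑ g (λ b → ind (NE a b) (dTs a) + ind (NE a b) (dTs b)))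
      ≡⟨ ∑∑-+ g g (λ a b → ind (NE a b) (dTs a)) (λ a b → ind (NE a b) (dTs b)) ⟩
        ∑ g (λ a → ∑ g (λ b → ind (NE a b) (dTs a))) + ∑ g (λ a → ∑ g (λ b → ind (NE a b) (dTs b)))
      ≡⟨ cong₂ _+_ (trans (∑-cong g _ _ (λ a → ∑-off-diagonal-const g1 a (dTs a))) (∑-*ˡ g g1 dTs))
                   (trans (∑-swap g g (λ a b → ind (NE a b) (dTs b)))
                     (trans (∑-cong g _ _ (λ b → trans (∑-cong g _ _ (λ a → cong (λ z → ind (not z) (dTs b)) (does-≟-sym a b))) (∑-off-diagonal-const g1 b (dTs b))))
                       (∑-*ˡ g g1 dTs))) ⟩
        g1 * D + g1 * D ∎

    ∑∑-cycle-part : ∑ g (λ a → ∑ g (λ b → ind (NE a b) (cycleTerm a b))) ≡ g * ⌊g²/4⌋ + M * ⌊g²/4⌋ + M * ⌊g²/4⌋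
    ∑∑-cycle-part = begin
        ∑ g (λ a → ∑ g (λ b → ind (NE a b) (cycleTerm a b)))
      ≡⟨ ∑-cong g _ _ (λ a → ∑-cong g _ _ (λ b → restrict a b)) ⟩
        ∑ g (λ a → ∑ g (λ b → cycleTerm a b))
      ≡⟨ ∑∑-+ g g (λ a b → dC a b) (λ a b → m a * dC a b + m b * dC a b) ⟩
        ∑ g (λ a → ∑ g (λ b → dC a b)) + ∑ g (λ a → ∑ g (λ b → m a * dC a b + m b * dC a b))
      ≡⟨ cong (∑ g (λ a → ∑ g (λ b → dC a b)) +_) (∑∑-+ g g (λ a b → m a * dC a b) (λ a b → m b * dC a b)) ⟩
        ∑ g (λ a → ∑ g (λ b → dC a b)) + (∑ g (λ a → ∑ g (λ b → m a * dC a b)) + ∑ g (λ a → ∑ g (λ b → m b * dC a b)))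
      ≡⟨ cong₂ _+_ ∑∑dC (cong₂ _+_ ∑∑m·dC ∑∑dC·m) ⟩
        g * ⌊g²/4⌋ + (M * ⌊g²/4⌋ + M * ⌊g²/4⌋)
      ≡⟨ sym (+-assoc (g * ⌊g²/4⌋) _ _) ⟩
        g * ⌊g²/4⌋ + M * ⌊g²/4⌋ + M * ⌊g²/4⌋ ∎
      where
      restrict : ∀ a b → ind (NE a b) (cycleTerm a b) ≡ cycleTerm a b
      restrict a b with a ≟ b
      ... | yes refl rewrite dC-self a | *-zeroʳ (m a) = refl
      ... | no _ = refl
      ∑∑dC : ∑ g (λ a → ∑ g (λ b → dC a b)) ≡ g * ⌊g²/4⌋
      ∑∑dC = trans (∑-cong g _ _ ∑-dist-C≡⌊g²/4⌋) (∑-const g ⌊g²/4⌋)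
      ∑∑m·dC : ∑ g (λ a → ∑ g (λ b → m a * dC a b)) ≡ M * ⌊g²/4⌋
      ∑∑m·dC = trans (∑-cong g _ _ (λ a → trans (∑-*ˡ g (m a) (dC a)) (cong (m a *_) (∑-dist-C≡⌊g²/4⌋ a)))) (∑-*ʳ g ⌊g²/4⌋ m)
      ∑∑dC·m : ∑ g (λ a → ∑ g (λ b → m b * dC a b)) ≡ M * ⌊g²/4⌋
      ∑∑dC·m = trans (∑-swap g g (λ a b → m b * dC a b))
             (trans (∑-cong g _ _ (λ b → trans (∑-*ˡ g (m b) (λ a → dC a b)) (cong (m b *_) (trans (∑-cong g _ _ (λ a → dC-sym a b)) (∑-dist-C≡⌊g²/4⌋ b)))))
               (∑-*ʳ g ⌊g²/4⌋ m))

    ∑∑-off-diagonal-crossBlock : ∑ g (λ a → ∑ g (λ b → ind (NE a b) (crossBlock a b))) ≡ 2 * pairSum g pairTerm + (g1 * D + g1 * D) + (g * ⌊g²/4⌋ + M * ⌊g²/4⌋ + M * ⌊g²/4⌋)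
    ∑∑-off-diagonal-crossBlock = begin
        ∑ g (λ a → ∑ g (λ b → ind (NE a b) (crossBlock a b)))
      ≡⟨ ∑-cong g _ _ (λ a → ∑-cong g _ _ (λ b → trans (cong (ind (NE a b)) (crossBlock-decompose a b)) (trans (ind-+ (NE a b) (pairTerm a b + (dTs a + dTs b)) (cycleTerm a b)) (cong (_+ ind (NE a b) (cycleTerm a b)) (ind-+ (NE a b) (pairTerm a b) (dTs a + dTs b)))))) ⟩
        ∑ g (λ a → ∑ g (λ b → ind (NE a b) (pairTerm a b) + ind (NE a b) (dTs a + dTs b) + ind (NE a b) (cycleTerm a b)))
      ≡⟨ trans (∑∑-+ g g (λ a b → ind (NE a b) (pairTerm a b) + ind (NE a b) (dTs a + dTs b)) (λ a b → ind (NE a b) (cycleTerm a b))) (cong (_+ ∑ g (λ a → ∑ g (λ b → ind (NE a b) (cycleTerm a b)))) (∑∑-+ g g (λ a b → ind (NE a b) (pairTerm a b)) (λ a b → ind (NE a b) (dTs a + dTs b)))) ⟩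
        ∑ g (λ a → ∑ g (λ b → ind (NE a b) (pairTerm a b))) + ∑ g (λ a → ∑ g (λ b → ind (NE a b) (dTs a + dTs b))) + ∑ g (λ a → ∑ g (λ b → ind (NE a b) (cycleTerm a b)))
      ≡⟨ cong₂ _+_ (cong₂ _+_ (∑∑-off-diagonal≡2*pairSum g pairTerm pairTerm-sym) ∑∑-depth-part) ∑∑-cycle-part ⟩
        2 * pairSum g pairTerm + (g1 * D + g1 * D) + (g * ⌊g²/4⌋ + M * ⌊g²/4⌋ + M * ⌊g²/4⌋) ∎

    2n∸g≡g+2M : 2 * (g + M) ∸ g ≡ g + 2 * M
    2n∸g≡g+2M = trans (cong (_∸ g) (double g M)) (m+n∸m≡n g (g + 2 * M))
      where
      double : ∀ g M → 2 * (g + M) ≡ g + (g + 2 * M)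
      double = solve 2 (λ g M → con 2 :* (g :+ M) := g :+ (g :+ con 2 :* M)) refl

    2W-identity : 2 * W G ≡ (2 * n ∸ g) * ⌊g²/4⌋ + 2 * ((g ∸ 1) * D + ∑ g WT + pairSum g pairTerm)
    2W-identity = begin
        2 * W G
      ≡⟨ trans 2W≡∑∑dist (trans ∑∑dist≡∑∑block ∑∑block-split) ⟩
        2 * ∑ g WT + ∑ g (λ a → ∑ g (λ b → ind (NE a b) (crossBlock a b)))
      ≡⟨ cong (2 * ∑ g WT +_) ∑∑-off-diagonal-crossBlock ⟩
        2 * ∑ g WT + (2 * pairSum g pairTerm + (g1 * D + g1 * D) + (g * ⌊g²/4⌋ + M * ⌊g²/4⌋ + M * ⌊g²/4⌋))
      ≡⟨ rearrange (∑ g WT) (pairSum g pairTerm) D ⌊g²/4⌋ M g1 ⟩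
        ((suc g1) + 2 * M) * ⌊g²/4⌋ + 2 * (g1 * D + ∑ g WT + pairSum g pairTerm)
      ≡⟨ cong (λ z → z * ⌊g²/4⌋ + 2 * (g1 * D + ∑ g WT + pairSum g pairTerm)) (sym (trans (cong (λ z → 2 * z ∸ g) n≡g+M) 2n∸g≡g+2M)) ⟩
        (2 * n ∸ g) * ⌊g²/4⌋ + 2 * ((g ∸ 1) * D + ∑ g WT + pairSum g pairTerm) ∎
      where
      rearrange : ∀ Wt P D F M g1 → 2 * Wt + (2 * P + (g1 * D + g1 * D) + (suc g1 * F + M * F + M * F)) ≡ (suc g1 + 2 * M) * F + 2 * (g1 * D + Wt + P)
      rearrange = solve 6 (λ Wt P D F M g1 → con 2 :* Wt :+ (con 2 :* P :+ (g1 :* D :+ g1 :* D) :+ ((con 1 :+ g1) :* F :+ M :* F :+ M :* F))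
                         := (con 1 :+ g1 :+ con 2 :* M) :* F :+ con 2 :* (g1 :* D :+ Wt :+ P)) refl

lemma2p1 : (n g : ℕ) (G : Graph n) (u : Fin g → Fin n) →
    IsUnicyclicWith G g u →
    let T  = treeAdj G g u
        S  = inT G g u
        ni = λ i → count n (S i)
        dT = λ i → dsub (T i) (S i) (u i)
        WT = λ i → Wsub (T i) (S i)
        dC = λ i j → dist (cycAdj g u) (u i) (u j)
    in 2 * W G ≡ (2 * n ∸ g) * ((g * g) / 4)
                 + 2 * ((g ∸ 1) * ∑ g dT + ∑ g WT
                   + pairSum g (λ i j → (ni i ∸ 1) * dT j + (ni j ∸ 1) * dT i
                                         + (ni i ∸ 1) * (ni j ∸ 1) * dC i j))
lemma2p1 n zero G u (_ , _ , (() , _) , _)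
lemma2p1 n (suc g1) G u ((symG , _) , conn , (_ , uinj , cycE) , uniq) = UnicyclicGraph.Connected.2W-identity G u symG uinj cycE uniq conn
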